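{- For trees $T,T'$ of the same size, the following are equivalent: (i) $T\le_{\mathcal T}T'$ in the Tamari order; (ii) there exists $f\in F^+_{\mathrm{sym}}$ with $T'=T*f$; (iii) the word $S(T,T')$ contains no inverse letter $\hat a_{\alpha,r}^{ -1}$, that is, the Polish algorithm running on $(T,T')$ ends with $(T',T')$; (iv) the relation $\triangleright_T$ is included in $\triangleright_{T'}$.
   Context: Trees: finite binary rooted trees; $\bullet$ is the one-leaf tree, $T_0\wedge T_1$ the tree with subtrees $T_0,T_1$; size = number of internal nodes. Addresses are finite words over $\{0,1\}$; the $\alpha$-subtree: the $\emptyset$-subtree is $T$, and for $T=T_0\wedge T_1$ the $i\beta$-subtree is the $\beta$-subtree of $T_i$. Left rotation at $\alpha$ replaces an $\alpha$-subtree $T_0\wedge(T_1\wedge T_2)$ by $(T_0\wedge T_1)\wedge T_2$; $T\le_{\mathcal T}T'$ iff $T'$ is obtained from $T$ by finitely many left rotations. Thompson's group $F$: orientation-preserving piecewise-linear homeomorphisms of $[0,1]$ with finitely many breakpoints with dyadic rational coordinates and slopes integral powers of 2; $fg$ means $f$ followed by $g$. Let $x_0$ be $t/2$ on $[0,\frac12]$, $t-\frac14$ on $[\frac12,\frac34]$, $2t-1$ on $[\frac34,1]$. For $\alpha=e_1\cdots e_k$ let $I_\alpha=[s,s+2^{ -k}]$, $s=\sum_je_j2^{ -j}$, and $a_\alpha\in F$ the identity outside $I_\alpha$ and $\varphi_\alpha^{ -1}x_0\varphi_\alpha$ on $I_\alpha$ ($\varphi_\alpha$ the increasing affine map $I_\alpha\to[0,1]$).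 $F^+_{\mathrm{sym}}$ is the submonoid generated by all $a_\alpha$, and $\hat a_{\alpha,r}=a_\alpha a_{\alpha0}\cdots a_{\alpha0^{r-1}}$. Action: if $T$ has size $n$ with leaf addresses $\alpha_0,\dots,\alpha_n$ (left to right), the $I_{\alpha_i}$ subdivide $[0,1]$; for $f\in F$, $T*f=T'$ means $T'$ has size $n$ and $f$ maps each $I_{\alpha_i(T)}$ affinely onto $I_{\alpha_i(T')}$. Then $T*a_\alpha$ is defined iff the $\alpha$-subtree of $T$ has the form $T_0\wedge(T_1\wedge T_2)$, and is then the left rotation of $T$ at $\alpha$. Polish encoding: $\langle\bullet\rangle=\bullet$, $\langle T_0\wedge T_1\rangle=\langle T_0\rangle\langle T_1\rangle\circ$; $<^{\mathrm{Lex}}$ is lexicographic with $\bullet<\circ$. For equal-size $T,T'$ with $\langle T\rangle<^{\mathrm{Lex}}\langle T'\rangle$ and first difference at position $k$, $s(T,T')$ is the unique $\hat a_{\alpha,r}$ such that $T*\hat a_{\alpha,r}$ is defined and $\langle T*\hat a_{\alpha,r}\rangle$ and $\langle T'\rangle$ no longer differ at position $k$. The word $S(T,T')$ in letters $\hat a_{\alpha,r}^{\pm1}$ is defined recursively: $S(T,T')=\varepsilon$ (empty) if $T=T'$; $S(T,T')=s(T,T')\,S(T*s(T,T'),T')$ if $\langle T\rangle<^{\mathrm{Lex}}\langle T'\rangle$; $S(T,T')=S(T,T'*s(T',T))\,s(T',T)^{ -1}$ if $\langle T\rangle>^{\mathrm{Lex}}\langle T'\rangle$ (the Polish algorithm;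 the recursion terminates). Covering relation: label leaves of a size-$n$ tree $T$ by $0,\dots,n$ left to right, $\mathrm{add}_T(i)$ the address of leaf $i$; for $j>i$, $j\triangleright_Ti$ iff there is an address $\gamma$ with $\mathrm{add}_T(j)=\gamma1^p$, $p\ge1$, and $\mathrm{add}_T(i)$ beginning with $\gamma0$. -}

module Defs where

open import Data.Bool using (Bool; true; false; if_then_else_; _∧_)
open import Data.Nat using (ℕ; zero; suc; _<_; _≤_)
open import Data.List using (List; []; _∷_; _++_; length; map; upTo; replicate; drop; head; foldl)
open import Data.List.Relation.Binary.Pointwise using (Pointwise)
open import Data.List.Relation.Unary.All using (All)
open import Data.Maybe using (Maybe; just; nothing)
open import Data.Product using (Σ; ∃; ∃-syntax; _×_; _,_)
open import Data.Rational using (ℚ; 0ℚ; 1ℚ; ½; _+_; _*_; _-_; _≤ᵇ_) renaming (_≤_ to _≤ℚ_)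
open import Relation.Binary.PropositionalEquality using (_≡_)
open import Relation.Binary.Construct.Closure.ReflexiveTransitive using (Star)

infixr 6 _∧ᵗ_
data Tree : Set where
  ● : Tree
  _∧ᵗ_ : Tree → Tree → Tree

size : Tree → ℕ
size ● = 0
size (t ∧ᵗ u) = suc (size t Data.Nat.+ size u)

-- addresses: words over {0,1}, encoded as false = 0, true = 1
Addr : Set
Addr = List Bool

data LeftRotAt : Addr → Tree → Tree → Set where
  root : ∀ {t₀ t₁ t₂} → LeftRotAt [] (t₀ ∧ᵗ (t₁ ∧ᵗ t₂)) ((t₀ ∧ᵗ t₁) ∧ᵗ t₂)
  left : ∀ {α t t' u} → LeftRotAt α t t' → LeftRotAt (false ∷ α) (t ∧ᵗ u) (t' ∧ᵗ u)
  right : ∀ {α t u u'} → LeftRotAt α u u' → LeftRotAt (true ∷ α) (t ∧ᵗ u) (t ∧ᵗ u')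

LeftRot : Tree → Tree → Set
LeftRot T T' = ∃[ α ] LeftRotAt α T T'

_≤T_ : Tree → Tree → Set
T ≤T T' = Star LeftRot T T'

leaves : Tree → List Addr
leaves ● = [] ∷ []
leaves (t ∧ᵗ u) = map (false ∷_) (leaves t) ++ map (true ∷_) (leaves u)

two : ℚ
two = 1ℚ + 1ℚ

¼ ¾ : ℚ
¼ = ½ * ½
¾ = ½ + ¼

-- I_α = [start α , start α + len α]
start : Addr → ℚ
start [] = 0ℚ
start (e ∷ α) = (if e then ½ else 0ℚ) + ½ * start α

len : Addr → ℚ
len [] = 1ℚ
len (e ∷ α) = ½ * len α

pow2 : ℕ → ℚ
pow2 zero = 1ℚ
pow2 (suc k) = two * pow2 k

φ : Addr → ℚ → ℚ
φ α x = (x - start α) * pow2 (length α)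

φ⁻¹ : Addr → ℚ → ℚ
φ⁻¹ α y = start α + y * len α

x₀ : ℚ → ℚ
x₀ t = if t ≤ᵇ ½ then ½ * t else (if t ≤ᵇ ¾ then t - ¼ else two * t - 1ℚ)

a : Addr → ℚ → ℚ
a α x = if (start α ≤ᵇ x) ∧ (x ≤ᵇ (start α + len α)) then φ⁻¹ α (x₀ (φ α x)) else x

-- a word α₁ ⋯ αₖ in the generators of F⁺_sym, evaluated with the
-- convention "fg = f followed by g"
evalW : List Addr → ℚ → ℚ
evalW w x = foldl (λ y α → a α y) x w

InFsym⁺ : (ℚ → ℚ) → Set
InFsym⁺ f = ∃[ w ] (∀ x → f x ≡ evalW w x)

-- â_{α,r} = a_α a_{α0} ⋯ a_{α0^{r-1}}, as a word
hatW : Addr → ℕ → List Addr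
hatW α r = map (λ i → α ++ replicate i false) (upTo r)

AffOnto : (ℚ → ℚ) → Addr → Addr → Set
AffOnto f α β = ∀ x → start α ≤ℚ x → x ≤ℚ start α + len α → f x ≡ φ⁻¹ β (φ α x)

Acts : Tree → (ℚ → ℚ) → Tree → Set
Acts T f T' = size T ≡ size T' × Pointwise (AffOnto f) (leaves T) (leaves T')

data Sym : Set where
  • ∘ : Sym

polish : Tree → List Sym
polish ● = • ∷ []
polish (t ∧ᵗ u) = polish t ++ polish u ++ ∘ ∷ []

LexLtAt : List Sym → List Sym → ℕ → Set
LexLtAt xs ys k = ∃[ p ] ∃[ xs' ] ∃[ ys' ]
  (length p ≡ k × xs ≡ p ++ • ∷ xs' × ys ≡ p ++ ∘ ∷ ys')

symAt : ℕ → List Sym → Maybe Sym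
symAt k xs = head (drop k xs)

-- IsStep T T' α r T'' : s(T,T') = â_{α,r} and T * s(T,T') = T''
IsStep : Tree → Tree → Addr → ℕ → Tree → Set
IsStep T T' α r T'' = 1 ≤ r × ∃[ k ]
  (LexLtAt (polish T) (polish T') k
   × Acts T (evalW (hatW α r)) T''
   × symAt k (polish T'') ≡ symAt k (polish T'))

data Letter : Set where
  pos : Addr → ℕ → Letter
  neg : Addr → ℕ → Letter

data IsPos : Letter → Set where
  isPos : ∀ {α r} → IsPos (pos α r)

-- PolishS T T' w : S(T,T') = w  (graph of the recursive definition)
data PolishS : Tree → Tree → List Letter → Set where
  done : ∀ {T} → PolishS T T []
  fwd  : ∀ {T T' α r T'' w} → IsStep T T' α r T'' → PolishS T'' T' w →
         PolishS T T' (pos α r ∷ w)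
  bwd  : ∀ {T T' α r T'' w} → IsStep T' T α r T'' → PolishS T T'' w →
         PolishS T T' (w ++ neg α r ∷ [])

addrOf : Tree → ℕ → Maybe Addr
addrOf T i = head (drop i (leaves T))

Covers : Tree → ℕ → ℕ → Set
Covers T j i = i < j × ∃[ γ ] ∃[ p ] ∃[ β ]
  (addrOf T j ≡ just (γ ++ replicate (suc p) true)
   × addrOf T i ≡ just (γ ++ false ∷ β))

-- Everything goes through one invariant, the weight of a leaf j of T: the number of
-- leaves it covers. Since j ▷_T i iff i < j ≤ i + weight T j, condition (iv) says that
-- the weight vector of T is pointwise below that of T' (module Combinatorics).
--   (i) ⇒ (iv): a left rotation can only increase weights.
--   (iv) ⇒ (i), (iii): if T ≠ T' and T is dominated by T', the first difference of
--     the Polish words shows a leaf in T and a node in T'; the step s(T,T') is then a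
--     sequence of left rotations whose result is still dominated by T'. A measure that
--     rotations decrease makes the algorithm stop, with only positive letters, and the
--     rotations compose to T ≤ T'.
--   (i) ⇒ (ii): a rotation at α is the action of a_α (module Dyadic).
--   (ii), (iii) ⇒ (iv): every element of F⁺_sym is monotone and right-anchored
--     (it sends the right end of a dyadic interval to the right end of a dyadic interval
--     starting no later than the image of the left end), and such maps preserve covering.
module Submission where

open import Defs
open import Data.Bool using (Bool; true; false; T; if_then_else_; _∧_)
open import Data.Empty using (⊥; ⊥-elim)
open import Data.Unit using (⊤; tt)
open import Data.List using (List; []; _∷_; _++_; length; map; replicate; drop; head; reverse; _ʳ++_; applyUpTo)
open import Data.List.Properties using (length-++; length-map; length-replicate; ++-assoc; ++-identityʳ; map-++; map-∘; map-id; map-cong; map-applyUpTo; ∷-injectiveˡ; ∷-injectiveʳ; reverse-injective; ʳ++-defn)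
open import Data.List.Relation.Binary.Pointwise as PW using (Pointwise; _∷_; [])
open import Data.List.Relation.Unary.All using (All; []; _∷_)
open import Data.Maybe using (Maybe; just; nothing)
open import Data.Maybe.Properties using (just-injective)
import Data.Maybe as M
open import Data.Nat using (ℕ; zero; suc)
open import Data.Product using (∃-syntax; _×_; _,_; proj₁; proj₂)
open import Data.Sum using (_⊎_; inj₁; inj₂)
open import Function.Bundles using (_⇔_; mk⇔)
open import Relation.Binary.Construct.Closure.ReflexiveTransitive using (ε; _◅_; _◅◅_)
open import Relation.Binary.Definitions using (tri<; tri≈; tri>)
open import Relation.Binary.PropositionalEquality
open import Relation.Nullary using (¬_; yes; no; Dec)
open import Relation.Nullary.Decidable using (from-yes; from-no)

-- Weights, contexts and Polish words: the combinatorial half of the argument.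
module Combinatorics where
  open import Data.Nat using (_+_; _∸_; _≤_; _<_; z≤n; s≤s)
  open import Data.Nat.Properties
  open import Data.Nat.Solver using (module +-*-Solver)
  open +-*-Solver using (solve; _:=_; _:+_; _:*_; con)

  hd-drop-++ˡ : ∀ {A : Set} (xs ys : List A) j → j < length xs → head (drop j (xs ++ ys)) ≡ head (drop j xs)
  hd-drop-++ˡ (x ∷ xs) ys zero h = refl
  hd-drop-++ˡ (x ∷ xs) ys (suc j) (s≤s h) = hd-drop-++ˡ xs ys j h

  hd-drop-++ʳ : ∀ {A : Set} (xs ys : List A) u → head (drop (length xs + u) (xs ++ ys)) ≡ head (drop u ys)
  hd-drop-++ʳ [] ys u = refl
  hd-drop-++ʳ (x ∷ xs) ys u = hd-drop-++ʳ xs ys u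

  hd-drop-map : ∀ {A B : Set} (f : A → B) xs j → head (drop j (map f xs)) ≡ M.map f (head (drop j xs))
  hd-drop-map f [] zero = refl
  hd-drop-map f [] (suc j) = refl
  hd-drop-map f (x ∷ xs) zero = refl
  hd-drop-map f (x ∷ xs) (suc j) = hd-drop-map f xs j

  hd-drop-beyond : ∀ {A : Set} (xs : List A) j → length xs ≤ j → head (drop j xs) ≡ nothing
  hd-drop-beyond [] zero h = refl
  hd-drop-beyond [] (suc j) h = refl
  hd-drop-beyond (x ∷ xs) (suc j) (s≤s h) = hd-drop-beyond xs j h

  hd-drop-just : ∀ {A : Set} (xs : List A) j → j < length xs → ∃[ y ] (head (drop j xs) ≡ just y)
  hd-drop-just (x ∷ xs) zero h = x , refl
  hd-drop-just (x ∷ xs) (suc j) (s≤s h) = hd-drop-just xs j h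

  length-leaves : ∀ T → length (leaves T) ≡ suc (size T)
  length-leaves ● = refl
  length-leaves (A ∧ᵗ B) = begin
      length (map (false ∷_) (leaves A) ++ map (true ∷_) (leaves B))
    ≡⟨ length-++ (map (false ∷_) (leaves A)) ⟩
      length (map (false ∷_) (leaves A)) + length (map (true ∷_) (leaves B))
    ≡⟨ cong₂ _+_ (length-map (false ∷_) (leaves A)) (length-map (true ∷_) (leaves B)) ⟩
      length (leaves A) + length (leaves B)
    ≡⟨ cong₂ _+_ (length-leaves A) (length-leaves B) ⟩
      suc (size A) + suc (size B)
    ≡⟨ cong suc (+-suc (size A) (size B)) ⟩
      suc (size (A ∧ᵗ B))
    ∎
    where open ≡-Reasoning

  addrOf-l : ∀ A B j → j < suc (size A) → addrOf (A ∧ᵗ B) j ≡ M.map (false ∷_) (addrOf A j)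
  addrOf-l A B j h = trans (hd-drop-++ˡ (map (false ∷_) (leaves A)) _ j (subst (j <_) (sym (trans (length-map (false ∷_) (leaves A)) (length-leaves A))) h)) (hd-drop-map (false ∷_) (leaves A) j)

  addrOf-r : ∀ A B u → addrOf (A ∧ᵗ B) (suc (size A) + u) ≡ M.map (true ∷_) (addrOf B u)
  addrOf-r A B u = trans (cong (λ k → head (drop (k + u) (map (false ∷_) (leaves A) ++ map (true ∷_) (leaves B)))) (sym (trans (length-map (false ∷_) (leaves A)) (length-leaves A))))
    (trans (hd-drop-++ʳ (map (false ∷_) (leaves A)) _ u) (hd-drop-map (true ∷_) (leaves B) u))

  addrOf-beyond : ∀ T j → size T < j → addrOf T j ≡ nothing
  addrOf-beyond T j h = hd-drop-beyond (leaves T) j (subst (_≤ j) (sym (length-leaves T)) h)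

  addrOf-just : ∀ T j → j < suc (size T) → ∃[ λ' ] (addrOf T j ≡ just λ')
  addrOf-just T j h = hd-drop-just (leaves T) j (subst (j <_) (sym (length-leaves T)) h)

  map-just : ∀ {A B : Set} {f : A → B} m {y} → M.map f m ≡ just y → ∃[ x ] (m ≡ just x × f x ≡ y)
  map-just (just x) refl = x , refl , refl

  data SplitAt (a j : ℕ) : Set where
    below : j < a → SplitAt a j
    above : ∀ u → j ≡ a + u → SplitAt a j

  splitAt : ∀ a j → SplitAt a j
  splitAt zero j = above j refl
  splitAt (suc a) zero = below (s≤s z≤n)
  splitAt (suc a) (suc j) with splitAt a j
  ... | below h = below (s≤s h)
  ... | above u e = above u (cong suc e)

  -- The weight of a leaf j is the number of leaves it covers, i.e. the size of the
  -- largest subtree whose last leaf is j. Listing the left-subtree sizes of the internal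
  -- nodes in order gives the weights of leaves 0 … n - 1; leaf n has weight n.
  inorderWeights : Tree → List ℕ
  inorderWeights ● = []
  inorderWeights (A ∧ᵗ B) = inorderWeights A ++ size A ∷ inorderWeights B

  length-inorderWeights : ∀ T → length (inorderWeights T) ≡ size T
  length-inorderWeights ● = refl
  length-inorderWeights (A ∧ᵗ B) = trans (length-++ (inorderWeights A)) (trans (cong₂ _+_ (length-inorderWeights A) (cong suc (length-inorderWeights B))) (+-suc (size A) (size B)))

  nth : List ℕ → ℕ → ℕ
  nth [] j = 0
  nth (x ∷ xs) zero = x
  nth (x ∷ xs) (suc j) = nth xs j

  nth-++ˡ : ∀ xs ys j → j < length xs → nth (xs ++ ys) j ≡ nth xs j
  nth-++ˡ (x ∷ xs) ys zero h = refl
  nth-++ˡ (x ∷ xs) ys (suc j) (s≤s h) = nth-++ˡ xs ys j h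

  nth-++ʳ : ∀ xs ys u → nth (xs ++ ys) (length xs + u) ≡ nth ys u
  nth-++ʳ [] ys u = refl
  nth-++ʳ (x ∷ xs) ys u = nth-++ʳ xs ys u

  nth-beyond : ∀ xs j → length xs ≤ j → nth xs j ≡ 0
  nth-beyond [] j h = refl
  nth-beyond (x ∷ xs) (suc j) (s≤s h) = nth-beyond xs j h

  weights : Tree → List ℕ
  weights T = inorderWeights T ++ size T ∷ []

  -- `weight T j` is the weight of leaf j of T (0 beyond the last leaf).
  weight : Tree → ℕ → ℕ
  weight T j = nth (weights T) j

  length-weights : ∀ T → length (weights T) ≡ suc (size T)
  length-weights T = trans (length-++ (inorderWeights T)) (trans (+-comm (length (inorderWeights T)) 1) (cong suc (length-inorderWeights T)))

  weights-∧ : ∀ A B → weights (A ∧ᵗ B) ≡ weights A ++ (inorderWeights B ++ suc (size A + size B) ∷ [])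
  weights-∧ A B = trans (++-assoc (inorderWeights A) (size A ∷ inorderWeights B) (suc (size A + size B) ∷ []))
                        (sym (++-assoc (inorderWeights A) (size A ∷ []) (inorderWeights B ++ suc (size A + size B) ∷ [])))

  weight-inLeft : ∀ A B j → j < suc (size A) → weight (A ∧ᵗ B) j ≡ weight A j
  weight-inLeft A B j h = trans (cong (λ l → nth l j) (weights-∧ A B)) (nth-++ˡ (weights A) _ j (subst (j <_) (sym (length-weights A)) h))

  weight-inRight′ : ∀ A B u → weight (A ∧ᵗ B) (suc (size A) + u) ≡ nth (inorderWeights B ++ suc (size A + size B) ∷ []) u
  weight-inRight′ A B u = trans (cong (λ l → nth l (suc (size A) + u)) (weights-∧ A B))
    (trans (cong (λ k → nth (weights A ++ (inorderWeights B ++ suc (size A + size B) ∷ [])) (k + u)) (sym (length-weights A)))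
           (nth-++ʳ (weights A) _ u))

  weight-inRight : ∀ A B u → u < size B → weight (A ∧ᵗ B) (suc (size A) + u) ≡ weight B u
  weight-inRight A B u h = trans (weight-inRight′ A B u) (trans (nth-++ˡ (inorderWeights B) _ u h') (sym (nth-++ˡ (inorderWeights B) _ u h')))
    where
    h' : u < length (inorderWeights B)
    h' = subst (u <_) (sym (length-inorderWeights B)) h

  nth-last : ∀ xs n → nth (xs ++ n ∷ []) (length xs) ≡ n
  nth-last [] n = refl
  nth-last (x ∷ xs) n = nth-last xs n

  weight-root : ∀ A B → weight (A ∧ᵗ B) (suc (size A) + size B) ≡ suc (size A + size B)
  weight-root A B = trans (weight-inRight′ A B (size B)) (trans (cong (nth (inorderWeights B ++ _ ∷ [])) (sym (length-inorderWeights B))) (nth-last (inorderWeights B) _))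

  weight-last : ∀ T → weight T (size T) ≡ size T
  weight-last T = trans (cong (nth (weights T)) (sym (length-inorderWeights T))) (nth-last (inorderWeights T) (size T))

  weight-beyond : ∀ T j → size T < j → weight T j ≡ 0
  weight-beyond T j h = nth-beyond (weights T) j (subst (_≤ j) (sym (length-weights T)) h)

  weight-leaf : ∀ j → weight ● j ≡ 0
  weight-leaf zero = refl
  weight-leaf (suc j) = refl

  data WeightView (A B : Tree) (j : ℕ) : Set where
    inLeft : j < suc (size A) → weight (A ∧ᵗ B) j ≡ weight A j → WeightView A B j
    inRight : ∀ u → j ≡ suc (size A) + u → u < size B → weight (A ∧ᵗ B) j ≡ weight B u → WeightView A B j
    atRoot : j ≡ suc (size A) + size B → weight (A ∧ᵗ B) j ≡ suc (size A + size B) → WeightView A B j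
    outside : suc (size A + size B) < j → weight (A ∧ᵗ B) j ≡ 0 → WeightView A B j

  weightView : ∀ A B j → WeightView A B j
  weightView A B j with splitAt (suc (size A)) j
  ... | below h = inLeft h (weight-inLeft A B j h)
  ... | above u refl with <-cmp u (size B)
  ...   | tri< lt _ _ = inRight u refl lt (weight-inRight A B u lt)
  ...   | tri≈ _ refl _ = atRoot refl (weight-root A B)
  ...   | tri> _ _ gt = outside (+-monoʳ-< (suc (size A)) gt) (weight-beyond (A ∧ᵗ B) _ (+-monoʳ-< (suc (size A)) gt))

  weight≤index : ∀ T j → weight T j ≤ j
  weight≤index ● j = subst (_≤ j) (sym (weight-leaf j)) z≤n
  weight≤index (A ∧ᵗ B) j with weightView A B j
  ... | inLeft h e = subst (_≤ j) (sym e) (weight≤index A j)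
  ... | inRight u refl h e = subst (_≤ suc (size A) + u) (sym e) (≤-trans (weight≤index B u) (m≤n+m u (suc (size A))))
  ... | atRoot refl e = subst (_≤ suc (size A) + size B) (sym e) ≤-refl
  ... | outside h e = subst (_≤ j) (sym e) z≤n

  WeightCovers : Tree → ℕ → ℕ → Set
  WeightCovers T j i = i < j × j ≤ i + weight T j

  rightDepth : Tree → ℕ
  rightDepth ● = 0
  rightDepth (A ∧ᵗ B) = suc (rightDepth B)

  addrOf-last : ∀ T → addrOf T (size T) ≡ just (replicate (rightDepth T) true)
  addrOf-last ● = refl
  addrOf-last (A ∧ᵗ B) = trans (addrOf-r A B (size B)) (cong (M.map (true ∷_)) (addrOf-last B))

  ones⇒last : ∀ T u m → addrOf T u ≡ just (replicate m true) → u ≡ size T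
  ones⇒last ● zero m e = refl
  ones⇒last ● (suc zero) m ()
  ones⇒last ● (suc (suc u)) m ()
  ones⇒last (A ∧ᵗ B) u m e with splitAt (suc (size A)) u
  ... | below h with map-just (addrOf A u) (trans (sym (addrOf-l A B u h)) e)
  ...   | (x , e1 , e2) = ⊥-elim (aux m e2)
    where
    aux : ∀ m → false ∷ x ≢ replicate m true
    aux zero ()
    aux (suc m) ()
  ones⇒last (A ∧ᵗ B) u m e | above v refl with map-just (addrOf B v) (trans (sym (addrOf-r A B v)) e)
  ... | (x , e1 , e2) = aux m e2
    where
    aux : ∀ m → true ∷ x ≡ replicate m true → suc (size A) + v ≡ suc (size A + size B)
    aux zero ()
    aux (suc m) e3 = cong (suc (size A) +_) (ones⇒last B v m (trans e1 (cong just (∷-injectiveʳ e3))))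

  false≢true : false ≢ true
  false≢true ()

  addrOf-inLeft : ∀ A B j {e α} → j < suc (size A) → addrOf (A ∧ᵗ B) j ≡ just (e ∷ α) → e ≡ false × addrOf A j ≡ just α
  addrOf-inLeft A B j h eq with map-just (addrOf A j) (trans (sym (addrOf-l A B j h)) eq)
  ... | (x , ex , refl) = refl , ex

  addrOf-inRight : ∀ A B u {e α} → addrOf (A ∧ᵗ B) (suc (size A) + u) ≡ just (e ∷ α) → e ≡ true × addrOf B u ≡ just α
  addrOf-inRight A B u eq with map-just (addrOf B u) (trans (sym (addrOf-r A B u)) eq)
  ... | (x , ex , refl) = refl , ex

  covers⇒weight : ∀ T i j → Covers T j i → WeightCovers T j i
  covers⇒weight ● i zero (() , _)
  covers⇒weight ● i (suc zero) (_ , γ , p , β , () , _)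
  covers⇒weight ● i (suc (suc j)) (_ , γ , p , β , () , _)
  covers⇒weight (A ∧ᵗ B) i j (i<j , γ , p , β , ej , ei) with weightView A B j
  ... | atRoot refl e = i<j , subst (λ z → suc (size A) + size B ≤ i + z) (sym e) (m≤n+m (suc (size A + size B)) i)
  ... | outside h e with trans (sym (addrOf-beyond (A ∧ᵗ B) j h)) ej
  ...   | ()
  covers⇒weight (A ∧ᵗ B) i j (i<j , [] , p , β , ej , ei) | inLeft h e =
    ⊥-elim (false≢true (sym (proj₁ (addrOf-inLeft A B j h ej))))
  covers⇒weight (A ∧ᵗ B) i j (i<j , _ ∷ γ , p , β , ej , ei) | inLeft h e
    with covers⇒weight A i j (i<j , γ , p , β , proj₂ (addrOf-inLeft A B j h ej) , proj₂ (addrOf-inLeft A B i (<-trans i<j h) ei))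
  ... | (_ , le) = i<j , subst (λ z → j ≤ i + z) (sym e) le
  covers⇒weight (A ∧ᵗ B) i j (i<j , [] , p , β , ej , ei) | inRight u refl h e =
    ⊥-elim (<-irrefl (ones⇒last B u p (proj₂ (addrOf-inRight A B u ej))) h)
  covers⇒weight (A ∧ᵗ B) i j (i<j , _ ∷ γ , p , β , ej , ei) | inRight u refl h e with splitAt (suc (size A)) i
  ... | below h' = ⊥-elim (false≢true (trans (sym (proj₁ (addrOf-inLeft A B i h' ei))) (proj₁ (addrOf-inRight A B u ej))))
  ... | above v refl with covers⇒weight B v u (+-cancelˡ-< (suc (size A)) v u i<j , γ , p , β , proj₂ (addrOf-inRight A B u ej) , proj₂ (addrOf-inRight A B v ei))
  ...   | (_ , le) = i<j , subst (λ z → suc (size A) + u ≤ suc (size A) + v + z) (sym e)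
                       (subst (suc (size A) + u ≤_) (sym (+-assoc (suc (size A)) v (weight B u))) (+-monoʳ-≤ (suc (size A)) le))

  weight⇒covers : ∀ T i j → WeightCovers T j i → Covers T j i
  weight⇒covers ● i j (i<j , le) = ⊥-elim (<-irrefl refl (<-≤-trans i<j (subst (j ≤_) (trans (cong (i +_) (weight-leaf j)) (+-identityʳ i)) le)))
  weight⇒covers (A ∧ᵗ B) i j (i<j , le) = byView (weightView A B j)
    where
    byView : WeightView A B j → Covers (A ∧ᵗ B) j i
    byView (inLeft h e) with weight⇒covers A i j (i<j , subst (λ z → j ≤ i + z) e le)
    ... | (_ , γ , p , β , ej , ei) = i<j , false ∷ γ , p , β , trans (addrOf-l A B j h) (cong (M.map (false ∷_)) ej) , trans (addrOf-l A B i (<-trans i<j h)) (cong (M.map (false ∷_)) ei)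
    byView (inRight u refl hu e) = byPositionOfI (splitAt (suc (size A)) i)
      where
      le' : suc (size A) + u ≤ i + weight B u
      le' = subst (λ z → suc (size A) + u ≤ i + z) e le
      byPositionOfI : SplitAt (suc (size A)) i → Covers (A ∧ᵗ B) j i
      byPositionOfI (below h') = ⊥-elim (<-irrefl refl (<-≤-trans (+-mono-<-≤ h' (weight≤index B u)) le'))
      byPositionOfI (above v refl) with weight⇒covers B v u (+-cancelˡ-< (suc (size A)) v u i<j , +-cancelˡ-≤ (suc (size A)) u (v + weight B u) (subst (suc (size A) + u ≤_) (+-assoc (suc (size A)) v (weight B u)) le'))
      ... | (_ , γ , p , β , ej , ei) = i<j , true ∷ γ , p , β , trans (addrOf-r A B u) (cong (M.map (true ∷_)) ej) , trans (addrOf-r A B v) (cong (M.map (true ∷_)) ei)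
    byView (atRoot refl e) = byPositionOfI (splitAt (suc (size A)) i)
      where
      byPositionOfI : SplitAt (suc (size A)) i → Covers (A ∧ᵗ B) j i
      byPositionOfI (below h') with addrOf-just A i h'
      ... | (λ' , eλ) = i<j , [] , rightDepth B , λ' , trans (addrOf-r A B (size B)) (cong (M.map (true ∷_)) (addrOf-last B)) , trans (addrOf-l A B i h') (cong (M.map (false ∷_)) eλ)
      byPositionOfI (above v refl) with weight⇒covers B v (size B) (+-cancelˡ-< (suc (size A)) v (size B) i<j , subst (size B ≤_) (cong (v +_) (sym (weight-last B))) (m≤n+m (size B) v))
      ... | (_ , γ , p , β , ej , ei) = i<j , true ∷ γ , p , β , trans (addrOf-r A B (size B)) (cong (M.map (true ∷_)) ej) , trans (addrOf-r A B v) (cong (M.map (true ∷_)) ei)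
    byView (outside h e) = ⊥-elim (<-irrefl refl (<-≤-trans i<j (subst (j ≤_) (trans (cong (i +_) e) (+-identityʳ i)) le)))

  CoverIncl : Tree → Tree → Set
  CoverIncl T T' = ∀ (i j : ℕ) → Covers T j i → Covers T' j i

  WeightDom : Tree → Tree → Set
  WeightDom T T' = ∀ j → weight T j ≤ weight T' j

  weightDom⇒coverIncl : ∀ {T T'} → WeightDom T T' → CoverIncl T T'
  weightDom⇒coverIncl {T} {T'} d i j c with covers⇒weight T i j c
  ... | (a1 , a2) = weight⇒covers T' i j (a1 , ≤-trans a2 (+-monoʳ-≤ i (d j)))

  coverIncl⇒weightDom : ∀ {T T'} → CoverIncl T T' → WeightDom T T'
  coverIncl⇒weightDom {T} {T'} inc j with weight T j in eq
  ... | zero = z≤n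
  ... | suc k = goal
    where
    i = j ∸ suc k
    k<j : suc k ≤ j
    k<j = subst (_≤ j) eq (weight≤index T j)
    i<j : i < j
    i<j = ∸-monoʳ-< {j} {suc k} {0} (s≤s z≤n) k<j
    c' : WeightCovers T' j i
    c' = covers⇒weight T' i j (inc i j (weight⇒covers T i j (i<j , subst (λ z → j ≤ i + z) (sym eq) (≤-reflexive (sym (m∸n+n≡m k<j))))))
    goal : suc k ≤ weight T' j
    goal = +-cancelˡ-≤ i (suc k) (weight T' j) (subst (_≤ i + weight T' j) (sym (m∸n+n≡m k<j)) (proj₂ c'))

  nth-mono : ∀ {xs ys} → Pointwise _≤_ xs ys → ∀ j → nth xs j ≤ nth ys j
  nth-mono [] j = z≤n
  nth-mono (h ∷ hs) zero = h
  nth-mono (h ∷ hs) (suc j) = nth-mono hs j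

  rot-size : ∀ {α T T'} → LeftRotAt α T T' → size T ≡ size T'
  rot-size (root {t₀} {t₁} {t₂}) = cong suc (solve 3 (λ a b c → a :+ (con 1 :+ (b :+ c)) := con 1 :+ (a :+ b) :+ c) refl (size t₀) (size t₁) (size t₂))
  rot-size (left r) = cong suc (cong (_+ _) (rot-size r))
  rot-size (right {t = t} r) = cong suc (cong (size t +_) (rot-size r))

  -- ... and can only increase weights: in (t₀ ∧ (t₁ ∧ t₂)) ↦ ((t₀ ∧ t₁) ∧ t₂) the
  -- last leaf of t₁ gains the leaves of t₀, all other weights are unchanged.
  rot-inorderWeights : ∀ {α T T'} → LeftRotAt α T T' → Pointwise _≤_ (inorderWeights T) (inorderWeights T')
  rot-inorderWeights (root {t₀} {t₁} {t₂}) = subst (Pointwise _≤_ (inorderWeights t₀ ++ size t₀ ∷ inorderWeights t₁ ++ size t₁ ∷ inorderWeights t₂)) (sym (++-assoc (inorderWeights t₀) (size t₀ ∷ inorderWeights t₁) _))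
    (PW.++⁺ (PW.refl ≤-refl) (≤-refl ∷ PW.++⁺ (PW.refl ≤-refl) (≤-trans (m≤n+m (size t₁) (size t₀)) (n≤1+n _) ∷ PW.refl ≤-refl)))
  rot-inorderWeights (left {t = t} {t'} {u} r) = subst (λ z → Pointwise _≤_ (inorderWeights t ++ size t ∷ inorderWeights u) (inorderWeights t' ++ z ∷ inorderWeights u)) (rot-size r) (PW.++⁺ (rot-inorderWeights r) (≤-refl ∷ PW.refl ≤-refl))
  rot-inorderWeights (right {t = t} r) = PW.++⁺ (PW.refl ≤-refl) (≤-refl ∷ rot-inorderWeights r)

  rot-weightDom : ∀ {α T T'} → LeftRotAt α T T' → WeightDom T T'
  rot-weightDom r = nth-mono (PW.++⁺ (rot-inorderWeights r) (≤-reflexive (rot-size r) ∷ []))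

  tamari-weightDom : ∀ {T T'} → T ≤T T' → WeightDom T T'
  tamari-weightDom ε j = ≤-refl
  tamari-weightDom ((α , r) ◅ s) j = ≤-trans (rot-weightDom r j) (tamari-weightDom s j)

  tamari-size : ∀ {T T'} → T ≤T T' → size T ≡ size T'
  tamari-size ε = refl
  tamari-size ((α , r) ◅ s) = trans (rot-size r) (tamari-size s)

  -- A measure strictly decreased by every left rotation; it bounds the number of
  -- steps of the Polish algorithm.
  rotMeasure : Tree → ℕ
  rotMeasure ● = 0
  rotMeasure (A ∧ᵗ B) = rotMeasure A + rotMeasure B + suc (size B)

  rot-rotMeasure : ∀ {α T T'} → LeftRotAt α T T' → rotMeasure T' < rotMeasure T
  rot-rotMeasure (root {t₀} {t₁} {t₂}) = subst (rotMeasure ((t₀ ∧ᵗ t₁) ∧ᵗ t₂) <_)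
    (solve 6 (λ a b c x y z → (a :+ b :+ (con 1 :+ y)) :+ c :+ (con 1 :+ z) :+ (con 1 :+ z) := a :+ (b :+ c :+ (con 1 :+ z)) :+ (con 1 :+ (con 1 :+ (y :+ z)))) refl (rotMeasure t₀) (rotMeasure t₁) (rotMeasure t₂) (size t₀) (size t₁) (size t₂))
    (m<m+n _ (s≤s z≤n))
  rot-rotMeasure (left {u = u} r) = +-monoˡ-< (suc (size u)) (+-monoˡ-< (rotMeasure u) (rot-rotMeasure r))
  rot-rotMeasure (right {t = t} {u} {u'} r) = subst (λ z → rotMeasure t + rotMeasure u' + suc z < rotMeasure t + rotMeasure u + suc (size u)) (rot-size r) (+-monoˡ-< (suc (size u)) (+-monoʳ-< (rotMeasure t) (rot-rotMeasure r)))

  leaves-order : ∀ T i j → i < j → ∀ {λi λj} → addrOf T i ≡ just λi → addrOf T j ≡ just λj →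
    ∃[ c ] ∃[ μ ] ∃[ ν ] (λi ≡ c ++ false ∷ μ × λj ≡ c ++ true ∷ ν)
  leaves-order ● i zero () ei ej
  leaves-order ● i (suc zero) h ei ()
  leaves-order ● i (suc (suc j)) h ei ()
  leaves-order (A ∧ᵗ B) i j i<j {λi} {λj} ei ej with splitAt (suc (size A)) i | splitAt (suc (size A)) j
  ... | below hi' | below hj with map-just (addrOf A i) (trans (sym (addrOf-l A B i hi')) ei) | map-just (addrOf A j) (trans (sym (addrOf-l A B j hj)) ej)
  ...   | (x , e1 , refl) | (y , e2 , refl) with leaves-order A i j i<j e1 e2
  ...     | (c , μ , ν , refl , refl) = false ∷ c , μ , ν , refl , refl
  leaves-order (A ∧ᵗ B) i j i<j {λi} {λj} ei ej | below hi' | above v refl with map-just (addrOf A i) (trans (sym (addrOf-l A B i hi')) ei) | map-just (addrOf B v) (trans (sym (addrOf-r A B v)) ej)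
  ... | (x , e1 , refl) | (y , e2 , refl) = [] , x , y , refl , refl
  leaves-order (A ∧ᵗ B) i j i<j {λi} {λj} ei ej | above u refl | below hj = ⊥-elim (<-irrefl refl (<-trans hj (≤-<-trans (m≤m+n (suc (size A)) u) i<j)))
  leaves-order (A ∧ᵗ B) i j i<j {λi} {λj} ei ej | above u refl | above v refl with map-just (addrOf B u) (trans (sym (addrOf-r A B u)) ei) | map-just (addrOf B v) (trans (sym (addrOf-r A B v)) ej)
  ... | (x , e1 , refl) | (y , e2 , refl) with leaves-order B u v (+-cancelˡ-< (suc (size A)) u v i<j) e1 e2
  ...   | (c , μ , ν , refl , refl) = true ∷ c , μ , ν , refl , refl

  -- One-hole contexts: a list of frames from the root to the hole. `holeL c` means
  -- the hole is in the left subtree with right sibling c, `holeR c` symmetrically.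
  data Frame : Set where
    holeL holeR : Tree → Frame

  Context : Set
  Context = List Frame

  plug : Context → Tree → Tree
  plug [] Z = Z
  plug (holeL c ∷ π) Z = plug π Z ∧ᵗ c
  plug (holeR c ∷ π) Z = c ∧ᵗ plug π Z

  contextAddr : Context → Addr
  contextAddr [] = []
  contextAddr (holeL c ∷ π) = false ∷ contextAddr π
  contextAddr (holeR c ∷ π) = true ∷ contextAddr π

  leftSiblings : Context → List Tree
  leftSiblings [] = []
  leftSiblings (holeL c ∷ π) = leftSiblings π
  leftSiblings (holeR c ∷ π) = c ∷ leftSiblings π

  offset : Context → ℕ
  offset [] = 0
  offset (holeL c ∷ π) = offset π
  offset (holeR c ∷ π) = suc (size c) + offset π

  plug-++ : ∀ π₁ π₂ Z → plug (π₁ ++ π₂) Z ≡ plug π₁ (plug π₂ Z)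
  plug-++ [] π₂ Z = refl
  plug-++ (holeL c ∷ π₁) π₂ Z = cong (_∧ᵗ c) (plug-++ π₁ π₂ Z)
  plug-++ (holeR c ∷ π₁) π₂ Z = cong (c ∧ᵗ_) (plug-++ π₁ π₂ Z)

  size-plug : ∀ π {Z Z'} → size Z ≡ size Z' → size (plug π Z) ≡ size (plug π Z')
  size-plug [] e = e
  size-plug (holeL c ∷ π) e = cong (λ z → suc (z + size c)) (size-plug π e)
  size-plug (holeR c ∷ π) e = cong (λ z → suc (size c + z)) (size-plug π e)

  rot-plug : ∀ π {α Z Z'} → LeftRotAt α Z Z' → LeftRotAt (contextAddr π ++ α) (plug π Z) (plug π Z')
  rot-plug [] r = r
  rot-plug (holeL c ∷ π) r = left (rot-plug π r)
  rot-plug (holeR c ∷ π) r = right (rot-plug π r)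

  offset+size≤ : ∀ π Z → offset π + size Z ≤ size (plug π Z)
  offset+size≤ [] Z = ≤-refl
  offset+size≤ (holeL c ∷ π) Z = ≤-trans (offset+size≤ π Z) (≤-trans (m≤m+n _ (size c)) (n≤1+n _))
  offset+size≤ (holeR c ∷ π) Z = subst (_≤ suc (size c + size (plug π Z))) (sym (+-assoc (suc (size c)) (offset π) (size Z))) (s≤s (+-monoʳ-≤ (size c) (offset+size≤ π Z)))

  weight-plug-inside : ∀ π Z t → t < size Z → weight (plug π Z) (offset π + t) ≡ weight Z t
  weight-plug-inside [] Z t h = refl
  weight-plug-inside (holeL c ∷ π) Z t h = trans (weight-inLeft (plug π Z) c (offset π + t) (s≤s (≤-trans (+-monoʳ-≤ (offset π) (<⇒≤ h)) (offset+size≤ π Z)))) (weight-plug-inside π Z t h)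
  weight-plug-inside (holeR c ∷ π) Z t h = trans (cong (weight (c ∧ᵗ plug π Z)) (+-assoc (suc (size c)) (offset π) t))
    (trans (weight-inRight c (plug π Z) (offset π + t) (<-≤-trans (+-monoʳ-< (offset π) h) (offset+size≤ π Z))) (weight-plug-inside π Z t h))

  weight-congˡ : ∀ {A A'} B → size A ≡ size A' → ∀ j → (j < suc (size A) → weight A j ≡ weight A' j) → weight (A ∧ᵗ B) j ≡ weight (A' ∧ᵗ B) j
  weight-congˡ {A} {A'} B es j h with weightView A B j
  ... | inLeft h1 e1 = trans e1 (trans (h h1) (sym (weight-inLeft A' B j (subst (λ z → j < suc z) es h1))))
  ... | inRight u refl h1 e1 = trans e1 (sym (trans (cong (λ z → weight (A' ∧ᵗ B) (suc z + u)) es) (weight-inRight A' B u h1)))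
  ... | atRoot refl e1 = trans e1 (sym (trans (cong (λ z → weight (A' ∧ᵗ B) (suc z + size B)) es) (trans (weight-root A' B) (cong (λ z → suc (z + size B)) (sym es)))))
  ... | outside h1 e1 = trans e1 (sym (weight-beyond (A' ∧ᵗ B) j (subst (λ z → suc (z + size B) < j) es h1)))

  weight-congʳ : ∀ A {B B'} → size B ≡ size B' → ∀ j → (∀ u → j ≡ suc (size A) + u → u < size B → weight B u ≡ weight B' u) → weight (A ∧ᵗ B) j ≡ weight (A ∧ᵗ B') j
  weight-congʳ A {B} {B'} es j h with weightView A B j
  ... | inLeft h1 e1 = trans e1 (sym (weight-inLeft A B' j h1))
  ... | inRight u refl h1 e1 = trans e1 (trans (h u refl h1) (sym (weight-inRight A B' u (subst (u <_) es h1))))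
  ... | atRoot refl e1 = trans e1 (sym (trans (cong (λ z → weight (A ∧ᵗ B') (suc (size A) + z)) es) (trans (weight-root A B') (cong (λ z → suc (size A + z)) (sym es)))))
  ... | outside h1 e1 = trans e1 (sym (weight-beyond (A ∧ᵗ B') j (subst (λ z → suc (size A + z) < j) es h1)))

  weight-plug-outside : ∀ π {Z Z'} → size Z ≡ size Z' → ∀ j → (j < offset π ⊎ offset π + size Z ≤ j) → weight (plug π Z) j ≡ weight (plug π Z') j
  weight-plug-outside [] {Z} {Z'} e j (inj₁ ())
  weight-plug-outside [] {Z} {Z'} e j (inj₂ h) with m≤n⇒m<n∨m≡n h
  ... | inj₁ lt = trans (weight-beyond Z j lt) (sym (weight-beyond Z' j (subst (_< j) e lt)))
  ... | inj₂ refl = trans (weight-last Z) (trans e (trans (sym (weight-last Z')) (cong (weight Z') (sym e))))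
  weight-plug-outside (holeL c ∷ π) e j h = weight-congˡ c (size-plug π e) j (λ _ → weight-plug-outside π e j h)
  weight-plug-outside (holeR c ∷ π) {Z} e j h = weight-congʳ c (size-plug π e) j (λ u ej hu → weight-plug-outside π e u (cond u ej h))
    where
    cond : ∀ u → j ≡ suc (size c) + u → (j < suc (size c) + offset π ⊎ suc (size c) + offset π + size Z ≤ j) → u < offset π ⊎ offset π + size Z ≤ u
    cond u refl (inj₁ lt) = inj₁ (+-cancelˡ-< (suc (size c)) u (offset π) lt)
    cond u refl (inj₂ le) = inj₂ (+-cancelˡ-≤ (suc (size c)) (offset π + size Z) u (subst (_≤ suc (size c) + u) (+-assoc (suc (size c)) (offset π) (size Z)) le))

  weight-plug-hole : ∀ π Z → size Z ≤ weight (plug π Z) (offset π + size Z)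
  weight-plug-hole [] Z = ≤-reflexive (sym (weight-last Z))
  weight-plug-hole (holeL c ∷ π) Z = subst (size Z ≤_) (sym (weight-inLeft (plug π Z) c (offset π + size Z) (s≤s (offset+size≤ π Z)))) (weight-plug-hole π Z)
  weight-plug-hole (holeR c ∷ π) Z = subst (λ k → size Z ≤ weight (c ∧ᵗ plug π Z) k) (sym (+-assoc (suc (size c)) (offset π) (size Z))) aux
    where
    aux : size Z ≤ weight (c ∧ᵗ plug π Z) (suc (size c) + (offset π + size Z))
    aux with m≤n⇒m<n∨m≡n (offset+size≤ π Z)
    ... | inj₁ lt = subst (size Z ≤_) (sym (weight-inRight c (plug π Z) _ lt)) (weight-plug-hole π Z)
    ... | inj₂ eq = subst (λ k → size Z ≤ weight (c ∧ᵗ plug π Z) (suc (size c) + k)) (sym eq)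
          (subst (size Z ≤_) (sym (weight-root c (plug π Z))) (≤-trans (m≤n+m (size Z) (offset π)) (≤-trans (≤-reflexive eq) (≤-trans (m≤n+m _ (size c)) (n≤1+n _)))))

  size≤plug : ∀ π Z → size Z ≤ size (plug π Z)
  size≤plug π Z = ≤-trans (m≤n+m (size Z) (offset π)) (offset+size≤ π Z)

  weight-nested : ∀ T j j' → j' < j → j ≤ j' + weight T j → j + weight T j' ≤ j' + weight T j
  weight-nested ● j j' h1 h2 = ⊥-elim (<-irrefl refl (<-≤-trans h1 (subst (j ≤_) (trans (cong (j' +_) (weight-leaf j)) (+-identityʳ j')) h2)))
  weight-nested (A ∧ᵗ B) j j' h1 h2 with weightView A B j
  ... | inLeft h e = subst (λ z → j + weight (A ∧ᵗ B) j' ≤ j' + z) (sym e) (subst (λ z → j + z ≤ j' + weight A j) (sym (weight-inLeft A B j' (<-trans h1 h))) (weight-nested A j j' h1 (subst (λ z → j ≤ j' + z) e h2)))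
  ... | atRoot refl e = subst (λ z → j + weight (A ∧ᵗ B) j' ≤ j' + z) (sym e) (subst (_≤ j' + suc (size A + size B)) (+-comm (weight (A ∧ᵗ B) j') (suc (size A) + size B)) (+-monoˡ-≤ _ (weight≤index (A ∧ᵗ B) j')))
  ... | outside h e = ⊥-elim (<-irrefl refl (<-≤-trans h1 (subst (j ≤_) (trans (cong (j' +_) e) (+-identityʳ j')) h2)))
  ... | inRight u refl hu e = byPositionOfJ′ (splitAt (suc (size A)) j')
    where
    h2' : suc (size A) + u ≤ j' + weight B u
    h2' = subst (λ z → suc (size A) + u ≤ j' + z) e h2
    byPositionOfJ′ : SplitAt (suc (size A)) j' → suc (size A) + u + weight (A ∧ᵗ B) j' ≤ j' + weight (A ∧ᵗ B) (suc (size A) + u)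
    byPositionOfJ′ (below h') = ⊥-elim (<-irrefl refl (<-≤-trans (+-mono-<-≤ h' (weight≤index B u)) h2'))
    byPositionOfJ′ (above v refl) = subst (λ z → suc (size A) + u + z ≤ suc (size A) + v + weight (A ∧ᵗ B) (suc (size A) + u)) (sym (weight-inRight A B v (<-trans vu hu)))
        (subst (λ z → suc (size A) + u + weight B v ≤ suc (size A) + v + z) (sym e)
          (subst₂ _≤_ (sym (+-assoc (suc (size A)) u (weight B v))) (sym (+-assoc (suc (size A)) v (weight B u)))
            (+-monoʳ-≤ (suc (size A)) (weight-nested B u v vu (+-cancelˡ-≤ (suc (size A)) u (v + weight B u) (subst (suc (size A) + u ≤_) (+-assoc (suc (size A)) v (weight B u)) h2'))))))
      where
      vu : v < u
      vu = +-cancelˡ-< (suc (size A)) v u h1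

  LeftSpine : Context → Set
  LeftSpine [] = ⊤
  LeftSpine (holeL c ∷ π) = LeftSpine π
  LeftSpine (holeR c ∷ π) = ⊥

  -- The rotations realising â_{α,r}: the tree X ∧ (Q ls), where Q ls has Y ∧ V at the
  -- end of the left spine ls, becomes ls[(X ∧ Y) ∧ V]. Weights only change at the last leaf
  -- e of X ∧ Y, which becomes its own index, and at some later leaves that then cover all
  -- leaves to their left.
  module SpineRotation (X Y V : Tree) where
    Q : Context → Tree
    Q ls = plug ls (Y ∧ᵗ V)
    beforeRot : Context → Tree
    beforeRot ls = X ∧ᵗ Q ls
    afterRot : Context → Tree
    afterRot ls = plug ls ((X ∧ᵗ Y) ∧ᵗ V)
    x e : ℕ
    x = suc (size X)
    e = suc (size X) + size Y

    size-afterRot : ∀ ls → LeftSpine ls → size (afterRot ls) ≡ size (beforeRot ls)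
    size-afterRot [] _ = cong suc (solve 3 (λ a b c → con 1 :+ (a :+ b) :+ c := a :+ (con 1 :+ (b :+ c))) refl (size X) (size Y) (size V))
    size-afterRot (holeL c ∷ ls) al = trans (cong (λ z → suc (z + size c)) (size-afterRot ls al)) (cong suc (solve 3 (λ a q c → con 1 :+ (a :+ q) :+ c := a :+ (con 1 :+ (q :+ c))) refl (size X) (size (Q ls)) (size c)))

    WeightChange : Context → ℕ → Set
    WeightChange ls t = weight (afterRot ls) t ≡ weight (beforeRot ls) t ⊎ (weight (afterRot ls) t ≡ t × (t ≡ e ⊎ (e < t × t ≤ x + weight (beforeRot ls) t)))

    weightChange-transport : ∀ ls ls' t → weight (afterRot ls) t ≡ weight (afterRot ls') t → weight (beforeRot ls) t ≡ weight (beforeRot ls') t → WeightChange ls' t → WeightChange ls t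
    weightChange-transport ls ls' t a b (inj₁ eq) = inj₁ (trans a (trans eq (sym b)))
    weightChange-transport ls ls' t a b (inj₂ (eq , inj₁ r)) = inj₂ (trans a eq , inj₁ r)
    weightChange-transport ls ls' t a b (inj₂ (eq , inj₂ (r1 , r2))) = inj₂ (trans a eq , inj₂ (r1 , subst (λ z → t ≤ x + z) (sym b) r2))

    weight-spineRotation : ∀ ls → LeftSpine ls → ∀ t → t < size (beforeRot ls) → WeightChange ls t
    weight-spineRotation [] _ t ht with weightView X (Y ∧ᵗ V) t
    ... | inLeft h e1 = inj₁ (trans (weight-inLeft (X ∧ᵗ Y) V t (≤-trans h (≤-trans (m≤m+n x (size Y)) (n≤1+n _)))) (trans (weight-inLeft X Y t h) (sym e1)))
    ... | atRoot refl _ = ⊥-elim (<-irrefl refl ht)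
    ... | outside h _ = ⊥-elim (<-irrefl refl (<-trans ht h))
    ... | inRight u refl hu e1 with weightView Y V u
    ...   | inLeft hu' e2 with m≤n⇒m<n∨m≡n (≤-pred hu')
    ...     | inj₁ lt = inj₁ (trans (weight-inLeft (X ∧ᵗ Y) V (x + u) (s≤s (+-monoʳ-≤ x (<⇒≤ lt)))) (trans (weight-inRight X Y u lt) (trans (sym e2) (sym e1))))
    ...     | inj₂ refl = inj₂ (trans (weight-inLeft (X ∧ᵗ Y) V (x + size Y) (s≤s ≤-refl)) (weight-root X Y) , inj₁ refl)
    weight-spineRotation [] _ t ht | inRight u refl hu e1 | inRight u' refl hu'' e2 = inj₁ (trans (cong (weight (afterRot [])) idx) (trans (weight-inRight (X ∧ᵗ Y) V u' hu'') (trans (sym e2) (sym e1))))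
      where
      idx : x + (suc (size Y) + u') ≡ suc (size (X ∧ᵗ Y)) + u'
      idx = solve 3 (λ a b c → con 1 :+ a :+ (con 1 :+ b :+ c) := con 1 :+ (con 1 :+ (a :+ b)) :+ c) refl (size X) (size Y) u'
    weight-spineRotation [] _ t ht | inRight u refl hu e1 | atRoot refl _ = ⊥-elim (<-irrefl refl hu)
    weight-spineRotation [] _ t ht | inRight u refl hu e1 | outside h _ = ⊥-elim (<-irrefl refl (<-trans hu h))
    weight-spineRotation (holeL c ∷ ls) al t ht with weightView X (Q ls ∧ᵗ c) t
    ... | atRoot refl _ = ⊥-elim (<-irrefl refl ht)
    ... | outside h _ = ⊥-elim (<-irrefl refl (<-trans ht h))
    ... | inLeft h e1 = weightChange-transport (holeL c ∷ ls) ls t (weight-inLeft (afterRot ls) c t (s≤s (subst (t ≤_) (sym (size-afterRot ls al)) (≤-trans (<⇒≤ h) (m≤m+n x (size (Q ls)))))))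
                     (trans e1 (sym (weight-inLeft X (Q ls) t h)))
                     (weight-spineRotation ls al t (≤-trans h (m≤m+n x (size (Q ls)))))
    ... | inRight u refl hu e1 with weightView (Q ls) c u
    ...   | inLeft hu' e2 with m≤n⇒m<n∨m≡n (≤-pred hu')
    ...     | inj₁ lt = weightChange-transport (holeL c ∷ ls) ls (x + u) (weight-inLeft (afterRot ls) c (x + u) (s≤s (subst (x + u ≤_) (sym (size-afterRot ls al)) (<⇒≤ (+-monoʳ-< x lt)))))
                     (trans e1 (trans e2 (sym (weight-inRight X (Q ls) u lt))))
                     (weight-spineRotation ls al (x + u) (+-monoʳ-< x lt))
    ...     | inj₂ refl = inj₂ (d2 , inj₂ (+-monoʳ-< x (<-≤-trans (n<1+n _) (≤-trans (m≤m+n (suc (size Y)) (size V)) (size≤plug ls (Y ∧ᵗ V)))) , ≤-reflexive (cong (x +_) (sym (trans e1 (trans e2 (weight-last (Q ls))))))))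
      where
      d2 : weight (afterRot (holeL c ∷ ls)) (x + size (Q ls)) ≡ x + size (Q ls)
      d2 = trans (weight-inLeft (afterRot ls) c (x + size (Q ls)) (s≤s (≤-reflexive (sym (size-afterRot ls al))))) (trans (cong (weight (afterRot ls)) (sym (size-afterRot ls al))) (trans (weight-last (afterRot ls)) (size-afterRot ls al)))
    weight-spineRotation (holeL c ∷ ls) al t ht | inRight u refl hu e1 | inRight u' refl hu'' e2 = inj₁ (trans (cong (weight (afterRot (holeL c ∷ ls))) idx) (trans (weight-inRight (afterRot ls) c u' hu'') (trans (sym e2) (sym e1))))
      where
      idx : x + (suc (size (Q ls)) + u') ≡ suc (size (afterRot ls)) + u'
      idx = trans (solve 3 (λ a b c → con 1 :+ a :+ (con 1 :+ b :+ c) := con 1 :+ (con 1 :+ (a :+ b)) :+ c) refl (size X) (size (Q ls)) u') (cong (λ z → suc z + u') (sym (size-afterRot ls al)))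
    weight-spineRotation (holeL c ∷ ls) al t ht | inRight u refl hu e1 | atRoot refl _ = ⊥-elim (<-irrefl refl hu)
    weight-spineRotation (holeL c ∷ ls) al t ht | inRight u refl hu e1 | outside h _ = ⊥-elim (<-irrefl refl (<-trans hu h))

  polishForest : List Tree → List Sym
  polishForest [] = []
  polishForest (t ∷ ts) = polish t ++ polishForest ts

  polishLeft : Context → List Sym
  polishLeft π = polishForest (leftSiblings π)

  polishRight : Context → List Sym
  polishRight [] = []
  polishRight (holeL c ∷ π) = polishRight π ++ polish c ++ ∘ ∷ []
  polishRight (holeR c ∷ π) = polishRight π ++ ∘ ∷ []

  polishForest-++ : ∀ F G → polishForest (F ++ G) ≡ polishForest F ++ polishForest G
  polishForest-++ [] G = refl
  polishForest-++ (t ∷ F) G = trans (cong (polish t ++_) (polishForest-++ F G)) (sym (++-assoc (polish t) (polishForest F) (polishForest G)))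

  polish-plug : ∀ π Z → polish (plug π Z) ≡ polishLeft π ++ polish Z ++ polishRight π
  polish-plug [] Z = sym (++-identityʳ (polish Z))
  polish-plug (holeL c ∷ π) Z = begin
      polish (plug π Z) ++ polish c ++ ∘ ∷ []
    ≡⟨ cong (_++ polish c ++ ∘ ∷ []) (polish-plug π Z) ⟩
      (polishLeft π ++ polish Z ++ polishRight π) ++ polish c ++ ∘ ∷ []
    ≡⟨ ++-assoc (polishLeft π) (polish Z ++ polishRight π) _ ⟩
      polishLeft π ++ (polish Z ++ polishRight π) ++ polish c ++ ∘ ∷ []
    ≡⟨ cong (polishLeft π ++_) (++-assoc (polish Z) (polishRight π) _) ⟩
      polishLeft π ++ polish Z ++ polishRight π ++ polish c ++ ∘ ∷ []
    ∎
    where open ≡-Reasoning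
  polish-plug (holeR c ∷ π) Z = begin
      polish c ++ polish (plug π Z) ++ ∘ ∷ []
    ≡⟨ cong (λ z → polish c ++ z ++ ∘ ∷ []) (polish-plug π Z) ⟩
      polish c ++ (polishLeft π ++ polish Z ++ polishRight π) ++ ∘ ∷ []
    ≡⟨ cong (polish c ++_) (++-assoc (polishLeft π) (polish Z ++ polishRight π) _) ⟩
      polish c ++ polishLeft π ++ (polish Z ++ polishRight π) ++ ∘ ∷ []
    ≡⟨ cong (λ z → polish c ++ polishLeft π ++ z) (++-assoc (polish Z) (polishRight π) _) ⟩
      polish c ++ polishLeft π ++ polish Z ++ polishRight π ++ ∘ ∷ []
    ≡⟨ sym (++-assoc (polish c) (polishLeft π) _) ⟩
      (polish c ++ polishLeft π) ++ polish Z ++ polishRight π ++ ∘ ∷ []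
    ∎
    where open ≡-Reasoning

  -- Stack-based parsing of Polish words; it recovers the forest, so Polish
  -- encoding is injective.
  parse : List Sym → List Tree → Maybe (List Tree)
  parse [] st = just st
  parse (• ∷ s) st = parse s (● ∷ st)
  parse (∘ ∷ s) (b ∷ a ∷ st) = parse s ((a ∧ᵗ b) ∷ st)
  parse (∘ ∷ s) _ = nothing

  parse-polish : ∀ T s st → parse (polish T ++ s) st ≡ parse s (T ∷ st)
  parse-polish ● s st = refl
  parse-polish (A ∧ᵗ B) s st = begin
      parse ((polish A ++ polish B ++ ∘ ∷ []) ++ s) st
    ≡⟨ cong (λ z → parse z st) (++-assoc (polish A) (polish B ++ ∘ ∷ []) s) ⟩
      parse (polish A ++ (polish B ++ ∘ ∷ []) ++ s) st
    ≡⟨ cong (λ z → parse (polish A ++ z) st) (++-assoc (polish B) (∘ ∷ []) s) ⟩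
      parse (polish A ++ polish B ++ ∘ ∷ s) st
    ≡⟨ parse-polish A _ st ⟩
      parse (polish B ++ ∘ ∷ s) (A ∷ st)
    ≡⟨ parse-polish B _ (A ∷ st) ⟩
      parse s ((A ∧ᵗ B) ∷ st)
    ∎
    where open ≡-Reasoning

  parse-concat : ∀ F s st → parse (polishForest F ++ s) st ≡ parse s (F ʳ++ st)
  parse-concat [] s st = refl
  parse-concat (t ∷ F) s st = trans (cong (λ z → parse z st) (++-assoc (polish t) (polishForest F) s)) (trans (parse-polish t _ st) (parse-concat F s (t ∷ st)))

  parse-polishForest : ∀ F → parse (polishForest F) [] ≡ just (F ʳ++ [])
  parse-polishForest F = trans (cong (λ z → parse z []) (sym (++-identityʳ (polishForest F)))) (parse-concat F [] [])

  ʳ++[]≡reverse : ∀ (F : List Tree) → F ʳ++ [] ≡ reverse F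
  ʳ++[]≡reverse F = trans (ʳ++-defn F) (++-identityʳ (reverse F))

  polishForest-injective : ∀ F G → polishForest F ≡ polishForest G → F ≡ G
  polishForest-injective F G e = reverse-injective (trans (sym (ʳ++[]≡reverse F)) (trans (just-injective (trans (sym (parse-polishForest F)) (trans (cong (λ z → parse z []) e) (parse-polishForest G)))) (ʳ++[]≡reverse G)))

  polish-injective : ∀ T T' → polish T ≡ polish T' → T ≡ T'
  polish-injective T T' e = ∷-injectiveˡ (polishForest-injective (T ∷ []) (T' ∷ []) (trans (++-identityʳ (polish T)) (trans e (sym (++-identityʳ (polish T'))))))

  length-polish : ∀ T → length (polish T) ≡ suc (size T + size T)
  length-polish ● = refl
  length-polish (A ∧ᵗ B) = trans (length-++ (polish A)) (trans (cong₂ _+_ (length-polish A) (trans (length-++ (polish B)) (cong (_+ 1) (length-polish B))))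
    (solve 2 (λ a b → (con 1 :+ (a :+ a)) :+ ((con 1 :+ (b :+ b)) :+ con 1) := con 1 :+ ((con 1 :+ (a :+ b)) :+ (con 1 :+ (a :+ b)))) refl (size A) (size B)))

  siblings-eq : ∀ F G X Y → polishForest F ≡ polishForest G ++ polish X ++ polish Y → F ≡ G ++ X ∷ Y ∷ []
  siblings-eq F G X Y e = polishForest-injective F (G ++ X ∷ Y ∷ [])
    (trans e (trans (cong (λ z → polishForest G ++ polish X ++ z) (sym (++-identityʳ (polish Y)))) (sym (polishForest-++ G (X ∷ Y ∷ [])))))

  firstDifference : ∀ (xs ys : List Sym) → length xs ≡ length ys → xs ≢ ys →
    ∃[ p ] ∃[ s ] ∃[ s' ] ∃[ xs' ] ∃[ ys' ] (xs ≡ p ++ s ∷ xs' × ys ≡ p ++ s' ∷ ys' × s ≢ s')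
  firstDifference [] [] e ne = ⊥-elim (ne refl)
  firstDifference (x ∷ xs) (y ∷ ys) e ne with x ≟s y
    where
    _≟s_ : (a b : Sym) → (a ≡ b) ⊎ (a ≢ b)
    • ≟s • = inj₁ refl
    ∘ ≟s ∘ = inj₁ refl
    • ≟s ∘ = inj₂ (λ ())
    ∘ ≟s • = inj₂ (λ ())
  ... | inj₂ nxy = [] , x , y , xs , ys , refl , refl , nxy
  ... | inj₁ refl with firstDifference xs ys (suc-injective e) (λ exy → ne (cong (x ∷_) exy))
  ...   | (p , s , s' , xs' , ys' , e1 , e2 , n) = x ∷ p , s , s' , xs' , ys' , cong (x ∷_) e1 , cong (x ∷_) e2 , n

  split-++ : ∀ (xs ys p : List Sym) s q → xs ++ ys ≡ p ++ s ∷ q →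
    (∃[ q' ] (xs ≡ p ++ s ∷ q')) ⊎ (∃[ p' ] (p ≡ xs ++ p' × ys ≡ p' ++ s ∷ q))
  split-++ [] ys p s q e = inj₂ (p , refl , e)
  split-++ (x ∷ xs) ys [] s q e = inj₁ (xs , cong (_∷ xs) (∷-injectiveˡ e))
  split-++ (x ∷ xs) ys (y ∷ p) s q e with split-++ xs ys p s q (∷-injectiveʳ e) | ∷-injectiveˡ e
  ... | inj₁ (q' , e') | refl = inj₁ (q' , cong (x ∷_) e')
  ... | inj₂ (p' , e1 , e2) | refl = inj₂ (p' , cong (x ∷_) e1 , e2)

  data SymbolAt (T : Tree) (p : List Sym) : Sym → Set where
    isLeaf : ∀ π → T ≡ plug π ● → p ≡ polishLeft π → SymbolAt T p •
    isNode : ∀ π X Y → T ≡ plug π (X ∧ᵗ Y) → p ≡ polishLeft π ++ polish X ++ polish Y → SymbolAt T p ∘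

  symbolAt : ∀ T p s q → polish T ≡ p ++ s ∷ q → SymbolAt T p s
  symbolAt ● [] .• .[] refl = isLeaf [] refl refl
  symbolAt ● (x ∷ []) s q ()
  symbolAt ● (x ∷ y ∷ p) s q ()
  symbolAt (A ∧ᵗ B) p s q e with split-++ (polish A) (polish B ++ ∘ ∷ []) p s q e
  ... | inj₁ (q' , eA) with symbolAt A p s q' eA
  ...   | isLeaf π e1 e2 = isLeaf (holeL B ∷ π) (cong (_∧ᵗ B) e1) e2
  ...   | isNode π X Y e1 e2 = isNode (holeL B ∷ π) X Y (cong (_∧ᵗ B) e1) e2
  symbolAt (A ∧ᵗ B) p s q e | inj₂ (p' , refl , e') with split-++ (polish B) (∘ ∷ []) p' s q e'
  ... | inj₁ (q' , eB) with symbolAt B p' s q' eB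
  ...   | isLeaf π e1 e2 = isLeaf (holeR A ∷ π) (cong (A ∧ᵗ_) e1) (cong (polish A ++_) e2)
  ...   | isNode π X Y e1 e2 = isNode (holeR A ∷ π) X Y (cong (A ∧ᵗ_) e1) (trans (cong (polish A ++_) e2) (sym (++-assoc (polish A) (polishLeft π) _)))
  symbolAt (A ∧ᵗ B) p s q e | inj₂ (p' , refl , e') | inj₂ (p'' , refl , e'') = aux p'' e''
    where
    aux : ∀ p'' → ∘ ∷ [] ≡ p'' ++ s ∷ q → SymbolAt (A ∧ᵗ B) (polish A ++ polish B ++ p'') s
    aux [] refl = isNode [] A B refl (cong (polish A ++_) (++-identityʳ (polish B)))
    aux (x ∷ []) ()
    aux (x ∷ y ∷ p) ()

  forestSize : List Tree → ℕ
  forestSize [] = 0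
  forestSize (c ∷ F) = suc (size c) + forestSize F

  offset-leftSiblings : ∀ π → offset π ≡ forestSize (leftSiblings π)
  offset-leftSiblings [] = refl
  offset-leftSiblings (holeL c ∷ π) = offset-leftSiblings π
  offset-leftSiblings (holeR c ∷ π) = cong (suc (size c) +_) (offset-leftSiblings π)

  leftSpine-offset : ∀ π → LeftSpine π → offset π ≡ 0
  leftSpine-offset [] _ = refl
  leftSpine-offset (holeL c ∷ π) a = leftSpine-offset π a

  leftSpine-leftSiblings : ∀ π → LeftSpine π → leftSiblings π ≡ []
  leftSpine-leftSiblings [] _ = refl
  leftSpine-leftSiblings (holeL c ∷ π) a = leftSpine-leftSiblings π a

  splitContext₁ : ∀ π Y → leftSiblings π ≡ Y ∷ [] → ∃[ ls₁ ] ∃[ ls₂ ] (π ≡ ls₁ ++ holeR Y ∷ ls₂ × LeftSpine ls₁)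
  splitContext₁ [] Y ()
  splitContext₁ (holeL c ∷ π) Y e with splitContext₁ π Y e
  ... | (ls₁ , ls₂ , refl , spine) = holeL c ∷ ls₁ , ls₂ , refl , spine
  splitContext₁ (holeR c ∷ π) Y e with ∷-injectiveˡ e
  ... | refl = [] , π , refl , tt

  splitContext : ∀ π F X Y → leftSiblings π ≡ F ++ X ∷ Y ∷ [] →
    ∃[ π₁ ] ∃[ ls₁ ] ∃[ ls₂ ] (π ≡ π₁ ++ holeR X ∷ ls₁ ++ holeR Y ∷ ls₂ × LeftSpine ls₁ × leftSiblings π₁ ≡ F)
  splitContext [] [] X Y ()
  splitContext [] (f ∷ F) X Y ()
  splitContext (holeL c ∷ π) F X Y e with splitContext π F X Y e
  ... | (π₁ , ls₁ , ls₂ , refl , spine , e') = holeL c ∷ π₁ , ls₁ , ls₂ , refl , spine , e'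
  splitContext (holeR c ∷ π) [] X Y e with ∷-injectiveˡ e
  ... | refl with splitContext₁ π Y (∷-injectiveʳ e)
  ...   | (ls₁ , ls₂ , refl , spine) = [] , ls₁ , ls₂ , refl , spine , refl
  splitContext (holeR c ∷ π) (f ∷ F) X Y e with ∷-injectiveˡ e
  ... | refl with splitContext π F X Y (∷-injectiveʳ e)
  ...   | (π₁ , ls₁ , ls₂ , refl , spine , e') = holeR c ∷ π₁ , ls₁ , ls₂ , refl , spine , cong (c ∷_) e'

  offset-++ : ∀ π₁ π₂ → offset (π₁ ++ π₂) ≡ offset π₁ + offset π₂
  offset-++ [] π₂ = refl
  offset-++ (holeL c ∷ π₁) π₂ = offset-++ π₁ π₂
  offset-++ (holeR c ∷ π₁) π₂ = trans (cong (suc (size c) +_) (offset-++ π₁ π₂)) (sym (+-assoc (suc (size c)) (offset π₁) (offset π₂)))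

  data RotSeq : List Addr → Tree → Tree → Set where
    rs-nil : ∀ {Z} → RotSeq [] Z Z
    rs-cons : ∀ {α w Z Z' Z''} → LeftRotAt α Z Z' → RotSeq w Z' Z'' → RotSeq (α ∷ w) Z Z''

  rs-lift : ∀ π {w Z Z'} → RotSeq w Z Z' → RotSeq (map (contextAddr π ++_) w) (plug π Z) (plug π Z')
  rs-lift π rs-nil = rs-nil
  rs-lift π (rs-cons r s) = rs-cons (rot-plug π r) (rs-lift π s)

  spineAddrs : ℕ → List Addr
  spineAddrs zero = []
  spineAddrs (suc n) = [] ∷ map (false ∷_) (spineAddrs n)

  spineRotations : ∀ X Y V ls → LeftSpine ls → RotSeq (spineAddrs (suc (length ls))) (X ∧ᵗ plug ls (Y ∧ᵗ V)) (plug ls ((X ∧ᵗ Y) ∧ᵗ V))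
  spineRotations X Y V [] _ = rs-cons root rs-nil
  spineRotations X Y V (holeL c ∷ ls) a = rs-cons root (rs-lift (holeL c ∷ []) (spineRotations X Y V ls a))

  rotSeq⇒tamari : ∀ {w Z Z'} → RotSeq w Z Z' → Z ≤T Z'
  rotSeq⇒tamari rs-nil = ε
  rotSeq⇒tamari (rs-cons r s) = (_ , r) ◅ rotSeq⇒tamari s

  applyUpTo-cong : ∀ {A : Set} (f g : ℕ → A) → (∀ i → f i ≡ g i) → ∀ n → applyUpTo f n ≡ applyUpTo g n
  applyUpTo-cong f g h zero = refl
  applyUpTo-cong f g h (suc n) = cong₂ _∷_ (h 0) (applyUpTo-cong (λ i → f (suc i)) (λ i → g (suc i)) (λ i → h (suc i)) n)

  spineAddrs-applyUpTo : ∀ α n → map (α ++_) (spineAddrs n) ≡ applyUpTo (λ i → α ++ replicate i false) n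
  spineAddrs-applyUpTo α zero = refl
  spineAddrs-applyUpTo α (suc n) = cong₂ _∷_ refl (trans (sym (map-∘ (spineAddrs n))) (trans (map-cong (λ β → sym (++-assoc α (false ∷ []) β)) (spineAddrs n))
    (trans (spineAddrs-applyUpTo (α ++ false ∷ []) n) (applyUpTo-cong _ _ (λ i → ++-assoc α (false ∷ []) (replicate i false)) n))))

  hatW≡spineAddrs : ∀ α n → hatW α n ≡ map (α ++_) (spineAddrs n)
  hatW≡spineAddrs α n = trans (map-applyUpTo (λ i → i) (λ i → α ++ replicate i false) n) (sym (spineAddrs-applyUpTo α n))

  rotSeq-size : ∀ {w Z Z'} → RotSeq w Z Z' → size Z ≡ size Z'
  rotSeq-size s = tamari-size (rotSeq⇒tamari s)

  symAt-at : ∀ (p : List Sym) s q → symAt (length p) (p ++ s ∷ q) ≡ just s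
  symAt-at [] s q = refl
  symAt-at (x ∷ p) s q = symAt-at p s q

  polish-reassoc : ∀ (a b c d : List Sym) → a ++ ((b ++ c ++ ∘ ∷ []) ++ d) ≡ (a ++ b ++ c) ++ ∘ ∷ d
  polish-reassoc (x ∷ a) b c d = cong (x ∷_) (polish-reassoc a b c d)
  polish-reassoc [] (x ∷ b) c d = cong (x ∷_) (polish-reassoc [] b c d)
  polish-reassoc [] [] (x ∷ c) d = cong (x ∷_) (polish-reassoc [] [] c d)
  polish-reassoc [] [] [] d = refl

  data OffsetView (s n j : ℕ) : Set where
    outL : j < s → OffsetView s n j
    outR : s + n ≤ j → OffsetView s n j
    inM : ∀ t → j ≡ s + t → t < n → OffsetView s n j

  offsetView : ∀ s n j → OffsetView s n j
  offsetView s n j with splitAt s j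
  ... | below h = outL h
  ... | above t refl with t <? n
  ...   | yes lt = inM t refl lt
  ...   | no nlt = outR (+-monoʳ-≤ s (≮⇒≥ nlt))

  -- The outcome of one forward step of the Polish algorithm from T towards T':
  -- rotations realising s(T,T') = â_{α,r} at the first difference k, leading to T'' which
  -- agrees with T' at k and is still dominated by T'.
  PolishStepResult : Tree → Tree → Set
  PolishStepResult T T' = ∃[ α ] ∃[ r ] ∃[ T'' ] ∃[ k ] (RotSeq (hatW α r) T T'' × 1 ≤ r × LexLtAt (polish T) (polish T') k × symAt k (polish T'') ≡ symAt k (polish T') × WeightDom T'' T')

  -- At the first difference of the Polish words T shows a leaf and T' a node X ∧ Y.
  -- Then the context of that leaf in T enters right children with left siblings X and
  -- then Y, separated by a left spine; rotating X down that spine is the Polish step.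
  module LeafVsNode (T T' : Tree) (dom : WeightDom T T') (p xs' ys' : List Sym)
    (e1 : polish T ≡ p ++ • ∷ xs') (e2 : polish T' ≡ p ++ ∘ ∷ ys')
    (π : Context) (eT : T ≡ plug π ●) (ep : p ≡ polishLeft π)
    (π' : Context) (X Y : Tree) (eT' : T' ≡ plug π' (X ∧ᵗ Y)) (ep' : p ≡ polishLeft π' ++ polish X ++ polish Y) where

    siblings : leftSiblings π ≡ leftSiblings π' ++ X ∷ Y ∷ []
    siblings = siblings-eq (leftSiblings π) (leftSiblings π') X Y (trans (sym ep) ep')

    module AfterSplit (π₁ ls₁ ls₂ : Context) (eπ : π ≡ π₁ ++ holeR X ∷ ls₁ ++ holeR Y ∷ ls₂)
                      (spine : LeftSpine ls₁) (eLS : leftSiblings π₁ ≡ leftSiblings π') where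
      open SpineRotation X Y (plug ls₂ ●)

      T'' : Tree
      T'' = plug π₁ (afterRot ls₁)

      s : ℕ
      s = offset π₁

      T≡beforeRot : T ≡ plug π₁ (beforeRot ls₁)
      T≡beforeRot = trans eT (trans (cong (λ z → plug z ●) eπ) (trans (plug-++ π₁ _ ●) (cong (λ z → plug π₁ (X ∧ᵗ z)) (plug-++ ls₁ (holeR Y ∷ ls₂) ●))))

      -- the step is â_{α,r}: α addresses the X-node and r - 1 is the length of the spine
      rotations : RotSeq (hatW (contextAddr π₁) (suc (length ls₁))) T T''
      rotations = subst₂ (λ w z → RotSeq w z T'') (sym (hatW≡spineAddrs (contextAddr π₁) (suc (length ls₁)))) (sym T≡beforeRot) (rs-lift π₁ (spineRotations X Y (plug ls₂ ●) ls₁ spine))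

      polish-T'' : polish T'' ≡ p ++ ∘ ∷ ((polish (plug ls₂ ●) ++ ∘ ∷ []) ++ polishRight ls₁) ++ polishRight π₁
      polish-T'' = begin
          polish T''
        ≡⟨ polish-plug π₁ (afterRot ls₁) ⟩
          polishLeft π₁ ++ polish (afterRot ls₁) ++ polishRight π₁
        ≡⟨ cong (λ z → polishLeft π₁ ++ z ++ polishRight π₁) (polish-plug ls₁ W) ⟩
          polishLeft π₁ ++ (polishLeft ls₁ ++ polish W ++ polishRight ls₁) ++ polishRight π₁
        ≡⟨ cong (λ z → polishLeft π₁ ++ (polishForest z ++ polish W ++ polishRight ls₁) ++ polishRight π₁) (leftSpine-leftSiblings ls₁ spine) ⟩
          polishLeft π₁ ++ (polish W ++ polishRight ls₁) ++ polishRight π₁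
        ≡⟨ cong (λ z → polishLeft π₁ ++ z ++ polishRight π₁) (++-assoc (polish (X ∧ᵗ Y)) (polish V ++ ∘ ∷ []) (polishRight ls₁)) ⟩
          polishLeft π₁ ++ (polish (X ∧ᵗ Y) ++ rest) ++ polishRight π₁
        ≡⟨ cong (polishLeft π₁ ++_) (++-assoc (polish (X ∧ᵗ Y)) rest (polishRight π₁)) ⟩
          polishLeft π₁ ++ (polish (X ∧ᵗ Y) ++ rest ++ polishRight π₁)
        ≡⟨ polish-reassoc (polishLeft π₁) (polish X) (polish Y) _ ⟩
          (polishLeft π₁ ++ polish X ++ polish Y) ++ ∘ ∷ rest ++ polishRight π₁
        ≡⟨ cong (λ z → (polishForest z ++ polish X ++ polish Y) ++ ∘ ∷ rest ++ polishRight π₁) eLS ⟩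
          (polishLeft π' ++ polish X ++ polish Y) ++ ∘ ∷ rest ++ polishRight π₁
        ≡⟨ cong (λ z → z ++ ∘ ∷ rest ++ polishRight π₁) (sym ep') ⟩
          p ++ ∘ ∷ rest ++ polishRight π₁
        ∎
        where
        open ≡-Reasoning
        V = plug ls₂ ●
        W = (X ∧ᵗ Y) ∧ᵗ V
        rest = (polish V ++ ∘ ∷ []) ++ polishRight ls₁

      sameSymbol : symAt (length p) (polish T'') ≡ symAt (length p) (polish T')
      sameSymbol = trans (cong (symAt (length p)) polish-T'') (trans (symAt-at p ∘ _) (sym (trans (cong (symAt (length p)) e2) (symAt-at p ∘ ys'))))

      weight-outside : ∀ j → j < s ⊎ s + size (beforeRot ls₁) ≤ j → weight T j ≡ weight T'' j
      weight-outside j h = trans (cong (λ z → weight z j) T≡beforeRot) (weight-plug-outside π₁ (sym (size-afterRot ls₁ spine)) j h)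

      weight-T : ∀ t → t < size (beforeRot ls₁) → weight T (s + t) ≡ weight (beforeRot ls₁) t
      weight-T t ht = trans (cong (λ z → weight z (s + t)) T≡beforeRot) (weight-plug-inside π₁ (beforeRot ls₁) t ht)

      weight-T'' : ∀ t → t < size (beforeRot ls₁) → weight T'' (s + t) ≡ weight (afterRot ls₁) t
      weight-T'' t ht = weight-plug-inside π₁ (afterRot ls₁) t (subst (t <_) (sym (size-afterRot ls₁ spine)) ht)

      weight-T'-XY : e ≤ weight T' (s + e)
      weight-T'-XY = subst (λ z → e ≤ weight z (s + e)) (sym eT') (subst (λ z → e ≤ weight (plug π' (X ∧ᵗ Y)) (z + e)) offset-eq (weight-plug-hole π' (X ∧ᵗ Y)))
        where
        offset-eq : offset π' ≡ s
        offset-eq = trans (offset-leftSiblings π') (trans (cong forestSize (sym eLS)) (sym (offset-leftSiblings π₁)))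

      -- a leaf whose weight grows to its full index t is still dominated in T':
      -- in T' it covers the last leaf of X ∧ Y, hence (nesting) everything that leaf covers
      dominated-grown : ∀ t → t < size (beforeRot ls₁) → e < t → t ≤ x + weight (beforeRot ls₁) t → t ≤ weight T' (s + t)
      dominated-grown t ht lt le = +-cancelˡ-≤ (s + e) t (weight T' (s + t)) (begin
          s + e + t                 ≡⟨ solve 3 (λ s t e → s :+ e :+ t := s :+ t :+ e) refl s t e ⟩
          s + t + e                 ≤⟨ +-monoʳ-≤ (s + t) weight-T'-XY ⟩
          s + t + weight T' (s + e) ≤⟨ weight-nested T' (s + t) (s + e) (+-monoʳ-< s lt) covered ⟩
          s + e + weight T' (s + t) ∎)
        where
        open ≤-Reasoning
        covered : s + t ≤ s + e + weight T' (s + t)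
        covered = ≤-trans (+-monoʳ-≤ s le) (subst (_≤ s + e + weight T' (s + t)) (+-assoc s x (weight (beforeRot ls₁) t))
                    (+-mono-≤ (+-monoʳ-≤ s (m≤m+n x (size Y))) (subst (_≤ weight T' (s + t)) (weight-T t ht) (dom (s + t)))))

      dominated : WeightDom T'' T'
      dominated j with offsetView s (size (beforeRot ls₁)) j
      ... | outL h = subst (_≤ weight T' j) (weight-outside j (inj₁ h)) (dom j)
      ... | outR h = subst (_≤ weight T' j) (weight-outside j (inj₂ h)) (dom j)
      ... | inM t refl ht with weight-spineRotation ls₁ spine t ht
      ...   | inj₁ eq = subst (_≤ weight T' (s + t)) (trans (weight-T t ht) (trans (sym eq) (sym (weight-T'' t ht)))) (dom (s + t))
      ...   | inj₂ (eqt , inj₁ refl) = subst (_≤ weight T' (s + e)) (sym (trans (weight-T'' e ht) eqt)) weight-T'-XY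
      ...   | inj₂ (eqt , inj₂ (lt , le)) = subst (_≤ weight T' (s + t)) (sym (trans (weight-T'' t ht) eqt)) (dominated-grown t ht lt le)

    result : PolishStepResult T T'
    result with splitContext π (leftSiblings π') X Y siblings
    ... | (π₁ , ls₁ , ls₂ , eπ , spine , eLS) = contextAddr π₁ , suc (length ls₁) , T'' , length p , rotations , s≤s z≤n , (p , xs' , ys' , refl , e1 , e2) , sameSymbol , dominated
      where open AfterSplit π₁ ls₁ ls₂ eπ spine eLS

  -- The opposite configuration, a node X ∧ Y in T against a leaf in T', contradicts
  -- domination: the last leaf of X ∧ Y has weight ≥ size (X ∧ Y) in T but only size Y in T'.
  module NodeVsLeaf (T T' : Tree) (dom : WeightDom T T') (p : List Sym)
    (π : Context) (X Y : Tree) (eT : T ≡ plug π (X ∧ᵗ Y)) (ep : p ≡ polishLeft π ++ polish X ++ polish Y)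
    (π' : Context) (eT' : T' ≡ plug π' ●) (ep' : p ≡ polishLeft π') where

    siblings : leftSiblings π' ≡ leftSiblings π ++ X ∷ Y ∷ []
    siblings = siblings-eq (leftSiblings π') (leftSiblings π) X Y (trans (sym ep') ep)

    j : ℕ
    j = offset π + size (X ∧ᵗ Y)

    weight-T : size (X ∧ᵗ Y) ≤ weight T j
    weight-T = subst (λ z → size (X ∧ᵗ Y) ≤ weight z j) (sym eT) (weight-plug-hole π (X ∧ᵗ Y))

    weight-T' : weight T' j ≡ size Y
    weight-T' with splitContext π' (leftSiblings π) X Y siblings
    ... | (π₁ , ls₁ , ls₂ , refl , spine , eLS) =
      trans (cong (λ z → weight z j) T'≡) (trans (cong (weight (plug σ (Y ∧ᵗ W))) (sym index))
        (trans (weight-plug-inside σ (Y ∧ᵗ W) (size Y) (s≤s (m≤m+n _ _))) (trans (weight-inLeft Y W (size Y) (n<1+n _)) (weight-last Y))))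
      where
      σ = π₁ ++ holeR X ∷ ls₁
      W = plug ls₂ ●
      T'≡ : T' ≡ plug σ (Y ∧ᵗ W)
      T'≡ = trans eT' (trans (cong (λ z → plug z ●) (sym (++-assoc π₁ (holeR X ∷ ls₁) (holeR Y ∷ ls₂)))) (plug-++ σ (holeR Y ∷ ls₂) ●))
      index : offset σ + size Y ≡ j
      index = begin
          offset σ + size Y
        ≡⟨ cong (_+ size Y) (offset-++ π₁ (holeR X ∷ ls₁)) ⟩
          offset π₁ + (suc (size X) + offset ls₁) + size Y
        ≡⟨ cong (λ z → offset π₁ + (suc (size X) + z) + size Y) (leftSpine-offset ls₁ spine) ⟩
          offset π₁ + (suc (size X) + 0) + size Y
        ≡⟨ cong (λ z → z + (suc (size X) + 0) + size Y) (trans (offset-leftSiblings π₁) (trans (cong forestSize eLS) (sym (offset-leftSiblings π)))) ⟩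
          offset π + (suc (size X) + 0) + size Y
        ≡⟨ solve 3 (λ o a b → o :+ (con 1 :+ a :+ con 0) :+ b := o :+ (con 1 :+ (a :+ b))) refl (offset π) (size X) (size Y) ⟩
          j
        ∎
        where open ≡-Reasoning

    absurd : ⊥
    absurd = <-irrefl refl (<-≤-trans (s≤s (m≤n+m (size Y) (size X))) (≤-trans (≤-trans weight-T (dom j)) (≤-reflexive weight-T')))

  polishStep : ∀ T T' → size T ≡ size T' → WeightDom T T' → T ≢ T' → PolishStepResult T T'
  polishStep T T' es dom ne with firstDifference (polish T) (polish T') (trans (length-polish T) (trans (cong (λ z → suc (z + z)) es) (sym (length-polish T')))) (λ e → ne (polish-injective T T' e))
  ... | (p , s , s' , xs' , ys' , e1 , e2 , s≢s') with symbolAt T p s xs' e1 | symbolAt T' p s' ys' e2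
  ...   | isLeaf π eT ep | isLeaf π' eT' ep' = ⊥-elim (s≢s' refl)
  ...   | isNode π X Y eT ep | isNode π' X' Y' eT' ep' = ⊥-elim (s≢s' refl)
  ...   | isNode π X Y eT ep | isLeaf π' eT' ep' = ⊥-elim (NodeVsLeaf.absurd T T' dom p π X Y eT ep π' eT' ep')
  ...   | isLeaf π eT ep | isNode π' X Y eT' ep' = LeafVsNode.result T T' dom p xs' ys' e1 e2 π eT ep π' X Y eT' ep'

-- Dyadic intervals, the generators a_α, and their action on trees.
module Dyadic where
  import Data.Rational
  open import Data.Rational using (ℚ; 0ℚ; 1ℚ; ½; _+_; _*_; _-_; -_; _≤ᵇ_) renaming (_≤_ to _≤q_; _<_ to _<q_)
  import Data.Rational.Properties as QP
  open QP using () renaming (≤-refl to ≤q-refl; ≤-trans to ≤q-trans; ≤-reflexive to ≤q-reflexive; <⇒≤ to <q⇒≤q; ≤-antisym to antisym)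
  open import Data.Rational.Solver using (module +-*-Solver)
  open +-*-Solver
  open Combinatorics using (CoverIncl; leaves-order; rot-size; RotSeq; rs-nil; rs-cons)

  -- Elementary order facts on ℚ, phrased so that ring identities can be discharged
  -- by the solver: u ≤ v follows from v = u + d with d ≥ 0.
  le-by : ∀ u v d → 0ℚ ≤q d → v ≡ u + d → u ≤q v
  le-by u v d h eq = subst₂ _≤q_ (QP.+-identityʳ u) (sym eq) (QP.+-monoʳ-≤ u h)

  lt-by : ∀ u v d → 0ℚ <q d → v ≡ u + d → u <q v
  lt-by u v d h eq = subst₂ _<q_ (QP.+-identityʳ u) (sym eq) (QP.+-mono-≤-< (≤q-refl {u}) h)

  diff-nn : ∀ {u v} → u ≤q v → 0ℚ ≤q v - u
  diff-nn {u} {v} h = subst (_≤q v - u) (QP.+-inverseʳ u) (QP.+-monoˡ-≤ (- u) h)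

  diff-pos : ∀ {u v} → u <q v → 0ℚ <q v - u
  diff-pos {u} {v} h = subst (_<q v - u) (QP.+-inverseʳ u) (QP.+-monoˡ-< (- u) h)

  mul-nn : ∀ {p q} → 0ℚ ≤q p → 0ℚ ≤q q → 0ℚ ≤q p * q
  mul-nn {p} {q} h1 h2 = subst (_≤q p * q) (QP.*-zeroʳ p) (QP.*-monoˡ-≤-nonNeg p {{Data.Rational.nonNegative h1}} h2)

  mul-pp : ∀ {p q} → 0ℚ <q p → 0ℚ <q q → 0ℚ <q p * q
  mul-pp {p} {q} h1 h2 = subst (_<q p * q) (QP.*-zeroʳ p) (QP.*-monoʳ-<-pos p {{Data.Rational.positive h1}} h2)

  0≤½ : 0ℚ ≤q ½
  0≤½ = from-yes (0ℚ QP.≤? ½)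
  0<½ : 0ℚ <q ½
  0<½ = from-yes (0ℚ QP.<? ½)
  0<1 : 0ℚ <q 1ℚ
  0<1 = from-yes (0ℚ QP.<? 1ℚ)

  ≤ᵇ-true : ∀ {p q} → p ≤q q → (p ≤ᵇ q) ≡ true
  ≤ᵇ-true {p} {q} h with p ≤ᵇ q in eq
  ... | true = refl
  ... | false = ⊥-elim (subst T eq (QP.≤⇒≤ᵇ h))

  ≤ᵇ-false : ∀ {p q} → ¬ (p ≤q q) → (p ≤ᵇ q) ≡ false
  ≤ᵇ-false {p} {q} h with p ≤ᵇ q in eq
  ... | true = ⊥-elim (h (QP.≤ᵇ⇒≤ (subst T (sym eq) tt)))
  ... | false = refl

  end : Addr → ℚ
  end α = start α + len α

  In : Addr → ℚ → Set
  In α x = start α ≤q x × x ≤q end α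

  len*pow2≡1 : ∀ α → len α * pow2 (length α) ≡ 1ℚ
  len*pow2≡1 [] = refl
  len*pow2≡1 (e ∷ α) = trans (solve 2 (λ L P → (con ½ :* L) :* (con two :* P) := L :* P) refl (len α) (pow2 (length α))) (len*pow2≡1 α)

  len-pos : ∀ α → 0ℚ <q len α
  len-pos [] = 0<1
  len-pos (e ∷ α) = mul-pp 0<½ (len-pos α)

  len-nn : ∀ α → 0ℚ ≤q len α
  len-nn α = <q⇒≤q (len-pos α)

  pow2-nn : ∀ n → 0ℚ ≤q pow2 n
  pow2-nn zero = <q⇒≤q 0<1
  pow2-nn (suc n) = mul-nn (from-yes (0ℚ QP.≤? two)) (pow2-nn n)

  digit-nonneg : ∀ (e : Bool) → 0ℚ ≤q (if e then ½ else 0ℚ)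
  digit-nonneg true = 0≤½
  digit-nonneg false = ≤q-refl

  start-nn : ∀ α → 0ℚ ≤q start α
  start-nn [] = ≤q-refl
  start-nn (e ∷ α) = QP.+-mono-≤ (digit-nonneg e) (mul-nn 0≤½ (start-nn α))

  end-le1 : ∀ α → end α ≤q 1ℚ
  end-le1 [] = ≤q-refl
  end-le1 (true ∷ α) = le-by _ _ (½ * (1ℚ - end α)) (mul-nn 0≤½ (diff-nn (end-le1 α)))
    (solve 2 (λ s L → con 1ℚ := (con ½ :+ con ½ :* s) :+ con ½ :* L :+ con ½ :* (con 1ℚ :- (s :+ L))) refl (start α) (len α))
  end-le1 (false ∷ α) = le-by _ _ (½ * (1ℚ - end α) + ½) (QP.+-mono-≤ (mul-nn 0≤½ (diff-nn (end-le1 α))) 0≤½)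
    (solve 2 (λ s L → con 1ℚ := (con 0ℚ :+ con ½ :* s) :+ con ½ :* L :+ (con ½ :* (con 1ℚ :- (s :+ L)) :+ con ½)) refl (start α) (len α))

  start-++ : ∀ α β → start (α ++ β) ≡ start α + len α * start β
  start-++ [] β = solve 1 (λ s → s := con 0ℚ :+ con 1ℚ :* s) refl (start β)
  start-++ (e ∷ α) β rewrite start-++ α β =
    solve 4 (λ c s L t → c :+ con ½ :* (s :+ L :* t) := (c :+ con ½ :* s) :+ (con ½ :* L) :* t) refl
      (if e then ½ else 0ℚ) (start α) (len α) (start β)

  len-++ : ∀ α β → len (α ++ β) ≡ len α * len β
  len-++ [] β = sym (QP.*-identityˡ (len β))
  len-++ (e ∷ α) β rewrite len-++ α β = sym (QP.*-assoc ½ (len α) (len β))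

  pow2-+ : ∀ m n → pow2 (m Data.Nat.+ n) ≡ pow2 m * pow2 n
  pow2-+ zero n = sym (QP.*-identityˡ (pow2 n))
  pow2-+ (suc m) n rewrite pow2-+ m n = sym (QP.*-assoc two (pow2 m) (pow2 n))

  pow2-++ : ∀ (α β : Addr) → pow2 (length (α ++ β)) ≡ pow2 (length α) * pow2 (length β)
  pow2-++ α β rewrite length-++ α {β} = pow2-+ (length α) (length β)

  φ-++ : ∀ α β x → φ (α ++ β) x ≡ φ β (φ α x)
  φ-++ α β x =
    begin
      (x - start (α ++ β)) * pow2 (length (α ++ β))
    ≡⟨ cong₂ (λ u v → (x - u) * v) (start-++ α β) (pow2-++ α β) ⟩
      (x - (s + L * t)) * (P * Q)
    ≡⟨ solve 6 (λ x s L t P Q → (x :- (s :+ L :* t)) :* (P :* Q) := ((x :- s) :* P :- (L :* P) :* t) :* Q) refl x s L t P Q ⟩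
      ((x - s) * P - (L * P) * t) * Q
    ≡⟨ cong (λ z → ((x - s) * P - z * t) * Q) (len*pow2≡1 α) ⟩
      ((x - s) * P - 1ℚ * t) * Q
    ≡⟨ solve 5 (λ x s t P Q → ((x :- s) :* P :- con 1ℚ :* t) :* Q := ((x :- s) :* P :- t) :* Q) refl x s t P Q ⟩
      ((x - s) * P - t) * Q
    ∎
    where
    open ≡-Reasoning
    s = start α
    L = len α
    t = start β
    P = pow2 (length α)
    Q = pow2 (length β)

  φ⁻¹-++ : ∀ α β y → φ⁻¹ (α ++ β) y ≡ φ⁻¹ α (φ⁻¹ β y)
  φ⁻¹-++ α β y rewrite start-++ α β | len-++ α β =
    solve 5 (λ y s L t M → s :+ L :* t :+ y :* (L :* M) := s :+ (t :+ y :* M) :* L) refl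
      y (start α) (len α) (start β) (len β)

  φφ⁻¹ : ∀ α y → φ α (φ⁻¹ α y) ≡ y
  φφ⁻¹ α y =
    begin
      (start α + y * len α - start α) * pow2 (length α)
    ≡⟨ solve 4 (λ s y L P → (s :+ y :* L :- s) :* P := y :* (L :* P)) refl (start α) y (len α) (pow2 (length α)) ⟩
      y * (len α * pow2 (length α))
    ≡⟨ cong (y *_) (len*pow2≡1 α) ⟩
      y * 1ℚ
    ≡⟨ QP.*-identityʳ y ⟩
      y
    ∎
    where open ≡-Reasoning

  φ⁻¹φ : ∀ α x → φ⁻¹ α (φ α x) ≡ x
  φ⁻¹φ α x =
    begin
      start α + (x - start α) * pow2 (length α) * len α
    ≡⟨ solve 4 (λ s x L P → s :+ (x :- s) :* P :* L := s :+ (x :- s) :* (L :* P)) refl (start α) x (len α) (pow2 (length α)) ⟩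
      start α + (x - start α) * (len α * pow2 (length α))
    ≡⟨ cong (λ z → start α + (x - start α) * z) (len*pow2≡1 α) ⟩
      start α + (x - start α) * 1ℚ
    ≡⟨ solve 2 (λ s x → s :+ (x :- s) :* con 1ℚ := x) refl (start α) x ⟩
      x
    ∎
    where open ≡-Reasoning

  φ⁻¹-mono : ∀ α {y z} → y ≤q z → φ⁻¹ α y ≤q φ⁻¹ α z
  φ⁻¹-mono α {y} {z} h = le-by _ _ ((z - y) * len α) (mul-nn (diff-nn h) (len-nn α))
    (solve 4 (λ s L y z → s :+ z :* L := s :+ y :* L :+ (z :- y) :* L) refl (start α) (len α) y z)

  φ⁻¹-smono : ∀ α {y z} → y <q z → φ⁻¹ α y <q φ⁻¹ α z
  φ⁻¹-smono α {y} {z} h = lt-by _ _ ((z - y) * len α) (mul-pp (diff-pos h) (len-pos α))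
    (solve 4 (λ s L y z → s :+ z :* L := s :+ y :* L :+ (z :- y) :* L) refl (start α) (len α) y z)

  φ-mono : ∀ α {x y} → x ≤q y → φ α x ≤q φ α y
  φ-mono α {x} {y} h = le-by _ _ ((y - x) * pow2 (length α)) (mul-nn (diff-nn h) (pow2-nn (length α)))
    (solve 4 (λ s P x y → (y :- s) :* P := (x :- s) :* P :+ (y :- x) :* P) refl (start α) (pow2 (length α)) x y)

  start≡ : ∀ α → φ⁻¹ α 0ℚ ≡ start α
  start≡ α = solve 2 (λ s L → s :+ con 0ℚ :* L := s) refl (start α) (len α)

  end≡ : ∀ α → φ⁻¹ α 1ℚ ≡ end α
  end≡ α = solve 2 (λ s L → s :+ con 1ℚ :* L := s :+ L) refl (start α) (len α)

  φ-start : ∀ α → φ α (start α) ≡ 0ℚ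
  φ-start α = trans (cong (φ α) (sym (start≡ α))) (φφ⁻¹ α 0ℚ)

  φ-end : ∀ α → φ α (end α) ≡ 1ℚ
  φ-end α = trans (cong (φ α) (sym (end≡ α))) (φφ⁻¹ α 1ℚ)

  start-++' : ∀ α β → start (α ++ β) ≡ φ⁻¹ α (start β)
  start-++' α β = trans (start-++ α β) (solve 3 (λ s L t → s :+ L :* t := s :+ t :* L) refl (start α) (len α) (start β))

  end-++' : ∀ α β → end (α ++ β) ≡ φ⁻¹ α (end β)
  end-++' α β rewrite start-++ α β | len-++ α β =
    solve 4 (λ s L t M → s :+ L :* t :+ L :* M := s :+ (t :+ M) :* L) refl (start α) (len α) (start β) (len β)

  sub-start : ∀ α β → start α ≤q start (α ++ β)
  sub-start α β = subst₂ _≤q_ (start≡ α) (sym (start-++' α β)) (φ⁻¹-mono α (start-nn β))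

  sub-end : ∀ α β → end (α ++ β) ≤q end α
  sub-end α β = subst₂ _≤q_ (sym (end-++' α β)) (end≡ α) (φ⁻¹-mono α (end-le1 β))

  start≤end : ∀ α → start α ≤q end α
  start≤end α = le-by _ _ (len α) (len-nn α) refl

  start<end : ∀ α → start α <q end α
  start<end α = lt-by _ _ (len α) (len-pos α) refl

  In-start : ∀ α → In α (start α)
  In-start α = ≤q-refl , start≤end α

  In-end : ∀ α → In α (end α)
  In-end α = start≤end α , ≤q-refl

  In-sub : ∀ α β {x} → In (α ++ β) x → In α x
  In-sub α β (h1 , h2) = ≤q-trans (sub-start α β) h1 , ≤q-trans h2 (sub-end α β)

  In-φ : ∀ α β {x} → In (α ++ β) x → In β (φ α x)
  In-φ α β {x} (h1 , h2) =
    subst (_≤q φ α x) (trans (cong (φ α) (start-++' α β)) (φφ⁻¹ α _)) (φ-mono α h1) ,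
    subst (φ α x ≤q_) (trans (cong (φ α) (end-++' α β)) (φφ⁻¹ α _)) (φ-mono α h2)

  <⇒≱ : ∀ {p q} → p <q q → ¬ (q ≤q p)
  <⇒≱ h1 h2 = QP.<-irrefl refl (QP.<-≤-trans h1 h2)

  ≤-rw : ∀ {p q r} → q ≡ r → p ≤q q → p ≤q r
  ≤-rw refl h = h
  ≤-lw : ∀ {p q r} → p ≡ q → p ≤q r → q ≤q r
  ≤-lw refl h = h

  In0 : ℚ → Set
  In0 = In []

  x₀-cases : ∀ t → (t ≤q ½ × x₀ t ≡ ½ * t) ⊎ ((½ <q t × t ≤q ¾ × x₀ t ≡ t - ¼) ⊎ (¾ <q t × x₀ t ≡ two * t - 1ℚ))
  x₀-cases t with t ≤ᵇ ½ in e1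
  ... | true = inj₁ (QP.≤ᵇ⇒≤ (subst T (sym e1) tt) , refl)
  ... | false with t ≤ᵇ ¾ in e2
  ...   | true = inj₂ (inj₁ (QP.≰⇒> (λ h → subst T e1 (QP.≤⇒≤ᵇ h)) , QP.≤ᵇ⇒≤ (subst T (sym e2) tt) , refl))
  ...   | false = inj₂ (inj₂ (QP.≰⇒> (λ h → subst T e2 (QP.≤⇒≤ᵇ h)) , refl))

  -- Each piece of x₀ is a lower bound for x₀ (x₀ is the maximum of its pieces), which
  -- gives monotonicity.
  x₀-lb1 : ∀ t → ½ * t ≤q x₀ t
  x₀-lb1 t with x₀-cases t
  ... | inj₁ (h , e) = ≤q-reflexive (sym e)
  ... | inj₂ (inj₁ (h1 , h2 , e)) = ≤-rw (sym e) (le-by _ _ (½ * (t - ½)) (mul-nn 0≤½ (diff-nn (<q⇒≤q h1)))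
        (solve 1 (λ t → t :- con ¼ := con ½ :* t :+ con ½ :* (t :- con ½)) refl t))
  ... | inj₂ (inj₂ (h , e)) = ≤-rw (sym e) (le-by _ _ ((½ + 1ℚ) * (t - ¾) + ½ * ¼) (QP.+-mono-≤ (mul-nn (from-yes (0ℚ QP.≤? (½ + 1ℚ))) (diff-nn (<q⇒≤q h))) (from-yes (0ℚ QP.≤? (½ * ¼))))
        (solve 1 (λ t → con two :* t :- con 1ℚ := con ½ :* t :+ ((con ½ :+ con 1ℚ) :* (t :- con ¾) :+ con ½ :* con ¼)) refl t))

  x₀-lb2 : ∀ t → t - ¼ ≤q x₀ t
  x₀-lb2 t with x₀-cases t
  ... | inj₁ (h , e) = ≤-rw (sym e) (le-by _ _ (½ * (½ - t)) (mul-nn 0≤½ (diff-nn h))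
        (solve 1 (λ t → con ½ :* t := (t :- con ¼) :+ con ½ :* (con ½ :- t)) refl t))
  ... | inj₂ (inj₁ (h1 , h2 , e)) = ≤q-reflexive (sym e)
  ... | inj₂ (inj₂ (h , e)) = ≤-rw (sym e) (le-by _ _ (t - ¾) (diff-nn (<q⇒≤q h))
        (solve 1 (λ t → con two :* t :- con 1ℚ := (t :- con ¼) :+ (t :- con ¾)) refl t))

  x₀-lb3 : ∀ t → two * t - 1ℚ ≤q x₀ t
  x₀-lb3 t with x₀-cases t
  ... | inj₁ (h , e) = ≤-rw (sym e) (le-by _ _ ((½ + 1ℚ) * (½ - t) + ¼) (QP.+-mono-≤ (mul-nn (from-yes (0ℚ QP.≤? (½ + 1ℚ))) (diff-nn h)) (from-yes (0ℚ QP.≤? ¼)))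
        (solve 1 (λ t → con ½ :* t := (con two :* t :- con 1ℚ) :+ ((con ½ :+ con 1ℚ) :* (con ½ :- t) :+ con ¼)) refl t))
  ... | inj₂ (inj₁ (h1 , h2 , e)) = ≤-rw (sym e) (le-by _ _ (¾ - t) (diff-nn h2)
        (solve 1 (λ t → t :- con ¼ := (con two :* t :- con 1ℚ) :+ (con ¾ :- t)) refl t))
  ... | inj₂ (inj₂ (h , e)) = ≤q-reflexive (sym e)

  x₀-mono : ∀ {x y} → x ≤q y → x₀ x ≤q x₀ y
  x₀-mono {x} {y} h with x₀-cases x
  ... | inj₁ (_ , e) = ≤-lw (sym e) (≤q-trans (le-by _ _ (½ * (y - x)) (mul-nn 0≤½ (diff-nn h))
        (solve 2 (λ x y → con ½ :* y := con ½ :* x :+ con ½ :* (y :- x)) refl x y)) (x₀-lb1 y))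
  ... | inj₂ (inj₁ (_ , _ , e)) = ≤-lw (sym e) (≤q-trans (le-by _ _ (y - x) (diff-nn h)
        (solve 2 (λ x y → y :- con ¼ := (x :- con ¼) :+ (y :- x)) refl x y)) (x₀-lb2 y))
  ... | inj₂ (inj₂ (_ , e)) = ≤-lw (sym e) (≤q-trans (le-by _ _ (two * (y - x)) (mul-nn (from-yes (0ℚ QP.≤? two)) (diff-nn h))
        (solve 2 (λ x y → con two :* y :- con 1ℚ := (con two :* x :- con 1ℚ) :+ con two :* (y :- x)) refl x y)) (x₀-lb3 y))

  x₀-In0 : ∀ {t} → In0 t → In0 (x₀ t)
  x₀-In0 (h1 , h2) = x₀-mono h1 , x₀-mono h2

  -- How x₀ moves the leaves of a rotation t₀ ∧ (t₁ ∧ t₂) ↦ (t₀ ∧ t₁) ∧ t₂: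
  -- 0μ ↦ 00μ, 10μ ↦ 01μ, 11μ ↦ 1μ.
  data RotationShape : Addr → Addr → Set where
    sh0 : ∀ μ → RotationShape (false ∷ μ) (false ∷ false ∷ μ)
    sh10 : ∀ μ → RotationShape (true ∷ false ∷ μ) (false ∷ true ∷ μ)
    sh11 : ∀ μ → RotationShape (true ∷ true ∷ μ) (true ∷ μ)

  ¾≰½ : ¬ (¾ ≤q ½)
  ¾≰½ = from-no (¾ QP.≤? ½)

  φ-suffix : ∀ β β* μ x → φ⁻¹ (β* ++ μ) (φ (β ++ μ) x) ≡ φ⁻¹ β* (φ β x)
  φ-suffix β β* μ x = trans (φ⁻¹-++ β* μ (φ (β ++ μ) x)) (cong (φ⁻¹ β*) (trans (cong (φ⁻¹ μ) (φ-++ β μ x)) (φ⁻¹φ μ (φ β x))))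

  x₀-shape : ∀ {β β*} → RotationShape β β* → ∀ t → In β t → x₀ t ≡ φ⁻¹ β* (φ β t)
  x₀-shape (sh0 μ) t h = trans xe (sym (φ-suffix (false ∷ []) (false ∷ false ∷ []) μ t))
    where
    t≤½ : t ≤q ½
    t≤½ = ≤q-trans (proj₂ h) (sub-end (false ∷ []) μ)
    xe : x₀ t ≡ φ⁻¹ (false ∷ false ∷ []) (φ (false ∷ []) t)
    xe with x₀-cases t
    ... | inj₁ (_ , e) = trans e (solve 1 (λ t → con ½ :* t := con (start (false ∷ false ∷ [])) :+ ((t :- con (start (false ∷ []))) :* con (pow2 1)) :* con (len (false ∷ false ∷ []))) refl t)
    ... | inj₂ (inj₁ (h1 , _)) = ⊥-elim (<⇒≱ h1 t≤½)
    ... | inj₂ (inj₂ (h1 , _)) = ⊥-elim (<⇒≱ (QP.<-trans (from-yes (½ QP.<? ¾)) h1) t≤½)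
  x₀-shape (sh10 μ) t h = trans xe (sym (φ-suffix (true ∷ false ∷ []) (false ∷ true ∷ []) μ t))
    where
    ½≤t : ½ ≤q t
    ½≤t = ≤q-trans (sub-start (true ∷ false ∷ []) μ) (proj₁ h)
    t≤¾ : t ≤q ¾
    t≤¾ = ≤q-trans (proj₂ h) (sub-end (true ∷ false ∷ []) μ)
    F : t - ¼ ≡ φ⁻¹ (false ∷ true ∷ []) (φ (true ∷ false ∷ []) t)
    F = solve 1 (λ t → t :- con ¼ := con (start (false ∷ true ∷ [])) :+ ((t :- con (start (true ∷ false ∷ []))) :* con (pow2 2)) :* con (len (false ∷ true ∷ []))) refl t
    xe : x₀ t ≡ φ⁻¹ (false ∷ true ∷ []) (φ (true ∷ false ∷ []) t)
    xe with x₀-cases t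
    ... | inj₁ (h1 , e) = trans e (trans (cong (½ *_) t≡½) (trans refl (trans (cong (_- ¼) (sym t≡½)) F)))
      where
      t≡½ : t ≡ ½
      t≡½ = antisym h1 ½≤t
    ... | inj₂ (inj₁ (_ , _ , e)) = trans e F
    ... | inj₂ (inj₂ (h1 , _)) = ⊥-elim (<⇒≱ h1 t≤¾)
  x₀-shape (sh11 μ) t h = trans xe (sym (φ-suffix (true ∷ true ∷ []) (true ∷ []) μ t))
    where
    ¾≤t : ¾ ≤q t
    ¾≤t = ≤q-trans (sub-start (true ∷ true ∷ []) μ) (proj₁ h)
    F : two * t - 1ℚ ≡ φ⁻¹ (true ∷ []) (φ (true ∷ true ∷ []) t)
    F = solve 1 (λ t → con two :* t :- con 1ℚ := con (start (true ∷ [])) :+ ((t :- con (start (true ∷ true ∷ []))) :* con (pow2 2)) :* con (len (true ∷ []))) refl t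
    xe : x₀ t ≡ φ⁻¹ (true ∷ []) (φ (true ∷ true ∷ []) t)
    xe with x₀-cases t
    ... | inj₁ (h1 , e) = ⊥-elim (¾≰½ (≤q-trans ¾≤t h1))
    ... | inj₂ (inj₁ (_ , h2 , e)) = trans e (trans (cong (_- ¼) t≡¾) (trans refl (trans (cong (λ z → two * z - 1ℚ) (sym t≡¾)) F)))
      where
      t≡¾ : t ≡ ¾
      t≡¾ = antisym h2 ¾≤t
    ... | inj₂ (inj₂ (_ , e)) = trans e F

  a-gen : ∀ α x b c → (start α ≤ᵇ x) ≡ b → (x ≤ᵇ end α) ≡ c → a α x ≡ (if b ∧ c then φ⁻¹ α (x₀ (φ α x)) else x)
  a-gen α x b c e1 e2 = cong₂ (λ b c → if b ∧ c then φ⁻¹ α (x₀ (φ α x)) else x) e1 e2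

  a-in : ∀ α {x} → In α x → a α x ≡ φ⁻¹ α (x₀ (φ α x))
  a-in α {x} (h1 , h2) = a-gen α x true true (≤ᵇ-true h1) (≤ᵇ-true h2)

  a-lt : ∀ α {x} → x <q start α → a α x ≡ x
  a-lt α {x} h = a-gen α x false (x ≤ᵇ end α) (≤ᵇ-false (<⇒≱ h)) refl

  a-gt : ∀ α {x} → end α <q x → a α x ≡ x
  a-gt α {x} h = aux (start α ≤ᵇ x) refl
    where
    aux : ∀ b → (start α ≤ᵇ x) ≡ b → a α x ≡ x
    aux true e = a-gen α x true false e (≤ᵇ-false (<⇒≱ h))
    aux false e = a-gen α x false false e (≤ᵇ-false (<⇒≱ h))

  a-start : ∀ α → a α (start α) ≡ start α
  a-start α = trans (a-in α (In-start α)) (trans (cong (λ z → φ⁻¹ α (x₀ z)) (φ-start α)) (start≡ α))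

  a-end : ∀ α → a α (end α) ≡ end α
  a-end α = trans (a-in α (In-end α)) (trans (cong (λ z → φ⁻¹ α (x₀ z)) (φ-end α)) (end≡ α))

  a-fixl : ∀ α {x} → x ≤q start α → a α x ≡ x
  a-fixl α {x} h with QP.<-cmp x (start α)
  ... | tri< lt _ _ = a-lt α lt
  ... | tri≈ _ refl _ = a-start α
  ... | tri> _ _ gt = ⊥-elim (<⇒≱ gt h)

  a-fixr : ∀ α {x} → end α ≤q x → a α x ≡ x
  a-fixr α {x} h with QP.<-cmp x (end α)
  ... | tri< lt _ _ = ⊥-elim (<⇒≱ lt h)
  ... | tri≈ _ refl _ = a-end α
  ... | tri> _ _ gt = a-gt α gt

  In-φ0 : ∀ α {x} → In α x → In0 (φ α x)
  In-φ0 α (h1 , h2) = ≤-lw (φ-start α) (φ-mono α h1) , ≤-rw (φ-end α) (φ-mono α h2)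

  In-φ⁻¹0 : ∀ α {y} → In0 y → In α (φ⁻¹ α y)
  In-φ⁻¹0 α (h1 , h2) = ≤-lw (start≡ α) (φ⁻¹-mono α h1) , ≤-rw (end≡ α) (φ⁻¹-mono α h2)

  a-In : ∀ α {x} → In α x → In α (a α x)
  a-In α {x} h = subst (In α) (sym (a-in α h)) (In-φ⁻¹0 α (x₀-In0 (In-φ0 α h)))

  a-mono : ∀ α {x y} → x ≤q y → a α x ≤q a α y
  a-mono α {x} {y} h with QP.≤-total x (start α)
  ... | inj₁ xs = ≤-lw (sym (a-fixl α xs)) ylow
    where
    ylow : x ≤q a α y
    ylow with QP.≤-total y (start α)
    ... | inj₁ ys = ≤-rw (sym (a-fixl α ys)) h
    ... | inj₂ sy with QP.≤-total y (end α)
    ...   | inj₁ ye = ≤q-trans xs (proj₁ (a-In α (sy , ye)))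
    ...   | inj₂ ey = ≤-rw (sym (a-fixr α ey)) h
  ... | inj₂ sx with QP.≤-total x (end α)
  ...   | inj₂ ex = ≤-lw (sym (a-fixr α ex)) (≤-rw (sym (a-fixr α (≤q-trans ex h))) h)
  ...   | inj₁ xe with QP.≤-total y (end α)
  ...     | inj₂ ey = ≤q-trans (proj₂ (a-In α (sx , xe))) (≤-rw (sym (a-fixr α ey)) ey)
  ...     | inj₁ ye = ≤-lw (sym (a-in α (sx , xe))) (≤-rw (sym (a-in α (≤q-trans sx h , ye))) (φ⁻¹-mono α (x₀-mono (φ-mono α h))))

  affOnto-identity : ∀ {f γ} → (∀ x → In γ x → f x ≡ x) → AffOnto f γ γ
  affOnto-identity {f} {γ} h x h1 h2 = trans (h x (h1 , h2)) (sym (φ⁻¹φ γ x))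

  aff-start : ∀ {f α β} → AffOnto f α β → f (start α) ≡ start β
  aff-start {f} {α} {β} h = trans (h (start α) ≤q-refl (start≤end α)) (trans (cong (φ⁻¹ β) (φ-start α)) (start≡ β))

  aff-end : ∀ {f α β} → AffOnto f α β → f (end α) ≡ end β
  aff-end {f} {α} {β} h = trans (h (end α) (start≤end α) ≤q-refl) (trans (cong (φ⁻¹ β) (φ-end α)) (end≡ β))

  aff-In : ∀ {f α β x} → AffOnto f α β → In α x → In β (f x)
  aff-In {f} {α} {β} {x} h (h1 , h2) = subst (In β) (sym (h x h1 h2)) (In-φ⁻¹0 β (In-φ0 α (h1 , h2)))

  aff-comp : ∀ {f g α β γ} → AffOnto f α β → AffOnto g β γ → AffOnto (λ x → g (f x)) α γ
  aff-comp {f} {g} {α} {β} {γ} h k x h1 h2 =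
    trans (k (f x) (proj₁ i) (proj₂ i)) (trans (cong (λ z → φ⁻¹ γ (φ β z)) (h x h1 h2)) (cong (φ⁻¹ γ) (φφ⁻¹ β (φ α x))))
    where
    i : In β (f x)
    i = aff-In {f} {α} {β} {x} h (h1 , h2)

  a-shape : ∀ α {β β*} → RotationShape β β* → AffOnto (a α) (α ++ β) (α ++ β*)
  a-shape α {β} {β*} sh x h1 h2 =
    trans (a-in α (In-sub α β (h1 , h2)))
     (trans (cong (φ⁻¹ α) (x₀-shape sh (φ α x) (In-φ α β (h1 , h2))))
      (trans (sym (φ⁻¹-++ α β* (φ β (φ α x)))) (cong (φ⁻¹ (α ++ β*)) (sym (φ-++ α β x)))))

  branch-order : ∀ c μ ν → end (c ++ false ∷ μ) ≤q start (c ++ true ∷ ν)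
  branch-order c μ ν = ≤-lw (sym (end-++' c (false ∷ μ))) (≤-rw (sym (start-++' c (true ∷ ν)))
    (φ⁻¹-mono c (≤q-trans (sub-end (false ∷ []) μ) (sub-start (true ∷ []) ν))))

  Incomparable : Addr → Addr → Set
  Incomparable γ α = ∃[ c ] ∃[ μ ] ∃[ ν ] ((γ ≡ c ++ false ∷ μ × α ≡ c ++ true ∷ ν) ⊎ (γ ≡ c ++ true ∷ ν × α ≡ c ++ false ∷ μ))

  incomparable-sides : ∀ {γ α} → Incomparable γ α → end γ ≤q start α ⊎ end α ≤q start γ
  incomparable-sides (c , μ , ν , inj₁ (refl , refl)) = inj₁ (branch-order c μ ν)
  incomparable-sides (c , μ , ν , inj₂ (refl , refl)) = inj₂ (branch-order c μ ν)

  a-fix-incomparable : ∀ {γ α x} → Incomparable γ α → In γ x → a α x ≡ x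
  a-fix-incomparable {γ} {α} ic (h1 , h2) with incomparable-sides ic
  ... | inj₁ le = a-fixl α (≤q-trans h2 le)
  ... | inj₂ le = a-fixr α (≤q-trans le h1)

  a-incomparable : ∀ {γ α} → Incomparable γ α → AffOnto (a α) γ γ
  a-incomparable {γ} {α} ic = affOnto-identity {a α} {γ} (λ x h → a-fix-incomparable {γ} {α} ic h)

  data AddrCmp (α γ : Addr) : Set where
    extends : ∀ β → γ ≡ α ++ β → AddrCmp α γ
    prefixOf : ∀ ρ → ρ ≢ [] → α ≡ γ ++ ρ → AddrCmp α γ
    incomparable : Incomparable γ α → AddrCmp α γ

  addrCmp : ∀ α γ → AddrCmp α γ
  addrCmp [] γ = extends γ refl
  addrCmp (e ∷ α) [] = prefixOf (e ∷ α) (λ ()) refl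
  addrCmp (e ∷ α) (e' ∷ γ) with addrCmp α γ
  ... | extends β eq = same-or-diff e e' (extends β (cong (e' ∷_) eq))
    where
    same-or-diff : ∀ e e' → AddrCmp (e' ∷ α) (e' ∷ γ) → AddrCmp (e ∷ α) (e' ∷ γ)
    same-or-diff true true h = h
    same-or-diff false false h = h
    same-or-diff true false _ = incomparable ([] , γ , α , inj₁ (refl , refl))
    same-or-diff false true _ = incomparable ([] , α , γ , inj₂ (refl , refl))
  ... | prefixOf ρ ne eq = same-or-diff e e' (prefixOf ρ ne (cong (e' ∷_) eq))
    where
    same-or-diff : ∀ e e' → AddrCmp (e' ∷ α) (e' ∷ γ) → AddrCmp (e ∷ α) (e' ∷ γ)
    same-or-diff true true h = h
    same-or-diff false false h = h
    same-or-diff true false _ = incomparable ([] , γ , α , inj₁ (refl , refl))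
    same-or-diff false true _ = incomparable ([] , α , γ , inj₂ (refl , refl))
  ... | incomparable (c , μ , ν , s) = same-or-diff e e'
    where
    lift' : ∀ {e'} → (γ ≡ c ++ false ∷ μ × α ≡ c ++ true ∷ ν) ⊎ (γ ≡ c ++ true ∷ ν × α ≡ c ++ false ∷ μ) → Incomparable (e' ∷ γ) (e' ∷ α)
    lift' {e'} (inj₁ (p , q)) = (e' ∷ c) , μ , ν , inj₁ (cong (e' ∷_) p , cong (e' ∷_) q)
    lift' {e'} (inj₂ (p , q)) = (e' ∷ c) , μ , ν , inj₂ (cong (e' ∷_) p , cong (e' ∷_) q)
    lift : ∀ {e'} → Incomparable (e' ∷ γ) (e' ∷ α)
    lift = lift' s
    same-or-diff : ∀ e e' → AddrCmp (e ∷ α) (e' ∷ γ)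
    same-or-diff true true = incomparable lift
    same-or-diff false false = incomparable lift
    same-or-diff true false = incomparable ([] , γ , α , inj₁ (refl , refl))
    same-or-diff false true = incomparable ([] , α , γ , inj₂ (refl , refl))

  -- Every element of F⁺_sym has
  -- this property, which is what makes it preserve the covering relation.
  RightAnchored : (ℚ → ℚ) → Set
  RightAnchored f = ∀ γ → ∃[ δ ] (end δ ≡ f (end γ) × start δ ≤q f (start γ))

  Monotone : (ℚ → ℚ) → Set
  Monotone f = ∀ {x y} → x ≤q y → f x ≤q f y

  end-t : ∀ α → end (α ++ true ∷ []) ≡ end α
  end-t α = trans (end-++' α (true ∷ [])) (end≡ α)

  end-f : ∀ α → end (α ++ false ∷ []) ≡ φ⁻¹ α ½
  end-f α = end-++' α (false ∷ [])

  shape-anchored : ∀ α {β β*} → RotationShape β β* → ∃[ δ ] (end δ ≡ a α (end (α ++ β)) × start δ ≤q a α (start (α ++ β)))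
  shape-anchored α {β} {β*} sh =
    α ++ β* , sym (aff-end {a α} {α ++ β} {α ++ β*} (a-shape α sh)) , ≤q-reflexive (sym (aff-start {a α} {α ++ β} {α ++ β*} (a-shape α sh)))

  -- The generators are right-anchored: for γ below α by the rotation shapes, for γ
  -- above α or disjoint from it because a_α fixes the endpoints of I_γ.
  a-rightAnchored-inside : ∀ α β → ∃[ δ ] (end δ ≡ a α (end (α ++ β)) × start δ ≤q a α (start (α ++ β)))
  a-rightAnchored-inside α [] rewrite ++-identityʳ α = α , sym (a-end α) , ≤q-reflexive (sym (a-start α))
  a-rightAnchored-inside α (false ∷ μ) = shape-anchored α (sh0 μ)
  a-rightAnchored-inside α (true ∷ []) = α , sym (trans (cong (a α) (end-t α)) (a-end α)) , proj₁ (a-In α (In-sub α (true ∷ []) (In-start (α ++ true ∷ []))))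
  a-rightAnchored-inside α (true ∷ false ∷ μ) = shape-anchored α (sh10 μ)
  a-rightAnchored-inside α (true ∷ true ∷ μ) = shape-anchored α (sh11 μ)

  a-rightAnchored : ∀ α → RightAnchored (a α)
  a-rightAnchored α γ with addrCmp α γ
  ... | extends β refl = a-rightAnchored-inside α β
  ... | prefixOf ρ _ refl = γ , sym (a-fixr (γ ++ ρ) (sub-end γ ρ)) , ≤q-reflexive (sym (a-fixl (γ ++ ρ) (sub-start γ ρ)))
  ... | incomparable ic = γ , sym (a-fix-incomparable {γ} {α} ic (In-end γ)) , ≤q-reflexive (sym (a-fix-incomparable {γ} {α} ic (In-start γ)))

  rightAnchored-∘ : ∀ {f g} → Monotone g → RightAnchored f → RightAnchored g → RightAnchored (λ x → g (f x))
  rightAnchored-∘ {f} {g} mg pf pg γ with pf γ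
  ... | δ , e1 , l1 with pg δ
  ...   | η , e2 , l2 = η , trans e2 (cong g e1) , ≤q-trans l2 (mg l1)

  rightAnchored-id : RightAnchored (λ x → x)
  rightAnchored-id γ = γ , refl , ≤q-refl

  evalW-monotone : ∀ w → Monotone (evalW w)
  evalW-monotone [] h = h
  evalW-monotone (α ∷ w) h = evalW-monotone w (a-mono α h)

  evalW-rightAnchored : ∀ w → RightAnchored (evalW w)
  evalW-rightAnchored [] = rightAnchored-id
  evalW-rightAnchored (α ∷ w) = rightAnchored-∘ {a α} {evalW w} (evalW-monotone w) (a-rightAnchored α) (evalW-rightAnchored w)

  ones-end : ∀ γ m → end (γ ++ replicate m true) ≡ end γ
  ones-end γ zero = cong end (++-identityʳ γ)
  ones-end γ (suc m) = trans (cong end (sym (++-assoc γ (true ∷ []) (replicate m true)))) (trans (ones-end (γ ++ true ∷ []) m) (end-t γ))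

  <-irr : ∀ {p} → ¬ (p <q p)
  <-irr = QP.<-irrefl refl

  ones-suffix : ∀ δ ρ → end (δ ++ ρ) ≡ end δ → ρ ≡ replicate (length ρ) true
  ones-suffix δ [] e = refl
  ones-suffix δ (true ∷ ρ) e = cong (true ∷_) (ones-suffix (δ ++ true ∷ []) ρ (trans (cong end (++-assoc δ (true ∷ []) ρ)) (trans e (sym (end-t δ)))))
  ones-suffix δ (false ∷ ρ) e = ⊥-elim (<-irr (QP.≤-<-trans (≤-lw e (≤-lw (cong end (++-assoc δ (false ∷ []) ρ)) (sub-end (δ ++ false ∷ []) ρ))) lt))
    where
    lt : end (δ ++ false ∷ []) <q end δ
    lt = subst₂ _<q_ (sym (end-f δ)) (end≡ δ) (φ⁻¹-smono δ (from-yes (½ QP.<? 1ℚ)))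

  Prefix : Addr → Addr → Set
  Prefix δ λ' = ∃[ ρ ] (λ' ≡ δ ++ ρ)

  overlap⇒prefix : ∀ δ λ' x → start δ ≤q x → x <q end δ → start λ' ≤q x → x <q end λ' → Prefix δ λ' ⊎ Prefix λ' δ
  overlap⇒prefix δ λ' x h1 h2 h3 h4 with addrCmp δ λ'
  ... | extends β eq = inj₁ (β , eq)
  ... | prefixOf ρ _ eq = inj₂ (ρ , eq)
  ... | incomparable ic with incomparable-sides ic
  ...   | inj₁ le = ⊥-elim (<-irr (QP.<-≤-trans h4 (≤q-trans le h1)))
  ...   | inj₂ le = ⊥-elim (<-irr (QP.<-≤-trans h2 (≤q-trans le h3)))

  rep-suffix : ∀ (xs ys : Addr) m → xs ++ ys ≡ replicate m true → ys ≡ replicate (length ys) true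
  rep-suffix [] ys m e = trans e (cong (λ z → replicate z true) (sym (trans (cong length e) (length-replicate m))))
  rep-suffix (x ∷ xs) ys (suc m) e = rep-suffix xs ys m (∷-injectiveʳ e)

  ones-after-branch : ∀ c μ ν δ σ m → c ++ false ∷ μ ≡ δ ++ σ → c ++ true ∷ ν ≡ δ ++ replicate m true → ν ≡ replicate (length ν) true
  ones-after-branch c μ ν [] σ m e1 e2 = ∷-injectiveʳ (rep-suffix c (true ∷ ν) m e2)
  ones-after-branch [] μ ν (d ∷ δ) σ m e1 e2 with trans (∷-injectiveˡ e1) (sym (∷-injectiveˡ e2))
  ... | ()
  ones-after-branch (c₀ ∷ c) μ ν (d ∷ δ) σ m e1 e2 = ones-after-branch c μ ν δ σ m (∷-injectiveʳ e1) (∷-injectiveʳ e2)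

  anchored⇒ones : ∀ c μ ν δ → end δ ≡ end (c ++ true ∷ ν) → start δ ≤q start (c ++ false ∷ μ) → ν ≡ replicate (length ν) true
  anchored⇒ones c μ ν δ eE sL = ones-from (λj-extends-δ)
    where
    λi : Addr
    λi = c ++ false ∷ μ
    λj : Addr
    λj = c ++ true ∷ ν
    si<ei : start λi <q end λi
    si<ei = start<end λi
    ei≤sj : end λi ≤q start λj
    ei≤sj = branch-order c μ ν
    sj<ej : start λj <q end λj
    sj<ej = start<end λj
    si<sj : start λi <q start λj
    si<sj = QP.<-≤-trans si<ei ei≤sj
    -- I_δ contains I_{c1ν} and ends with it, so c1ν = δ1^m
    λj-extends-δ : ∃[ m ] (λj ≡ δ ++ replicate m true)
    λj-extends-δ = aux (overlap⇒prefix δ λj (start λj) (≤q-trans sL (<q⇒≤q si<sj)) (subst (start λj <q_) (sym eE) sj<ej) ≤q-refl sj<ej)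
      where
      aux : Prefix δ λj ⊎ Prefix λj δ → ∃[ m ] (λj ≡ δ ++ replicate m true)
      aux (inj₁ (ρ , e)) = length ρ , trans e (cong (δ ++_) (ones-suffix δ ρ (trans (cong end (sym e)) (sym eE))))
      aux (inj₂ (ρ , e)) = ⊥-elim (<-irr (QP.<-≤-trans si<sj (≤q-trans (≤-rw (cong start (sym e)) (sub-start λj ρ)) sL)))
    -- I_δ also contains I_{c0μ}, so c0μ extends δ as well, which forces ν = 1 ⋯ 1
    ones-from : ∃[ m ] (λj ≡ δ ++ replicate m true) → ν ≡ replicate (length ν) true
    ones-from (m , e) = aux (overlap⇒prefix δ λi (start λi) sL (QP.<-≤-trans si<sj (≤q-trans (<q⇒≤q sj<ej) (≤q-reflexive (sym eE)))) ≤q-refl si<ei)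
      where
      aux : Prefix δ λi ⊎ Prefix λi δ → ν ≡ replicate (length ν) true
      aux (inj₁ (σ , e')) = ones-after-branch c μ ν δ σ m e' e
      aux (inj₂ (ρ , e')) = ⊥-elim (<-irr (QP.<-≤-trans sj<ej (≤-lw eE (≤q-trans (≤-lw (cong end (sym e')) (sub-end λi ρ)) ei≤sj))))

  pointwise-map : ∀ {R : Addr → Addr → Set} (f g : Addr → Addr) (xs : List Addr) → (∀ x → R (f x) (g x)) → Pointwise R (map f xs) (map g xs)
  pointwise-map f g [] h = []
  pointwise-map f g (x ∷ xs) h = h x ∷ pointwise-map f g xs h

  map-++-∷ : ∀ (π : Addr) e (L : List Addr) → map (π ++_) (map (e ∷_) L) ≡ map (λ x → π ++ e ∷ x) L
  map-++-∷ π e L = sym (map-∘ L)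

  map-++-∷∷ : ∀ (π : Addr) e e' (L : List Addr) → map (π ++_) (map (e ∷_) (map (e' ∷_) L)) ≡ map (λ x → π ++ e ∷ e' ∷ x) L
  map-++-∷∷ π e e' L = trans (cong (map (π ++_)) (sym (map-∘ L))) (sym (map-∘ L))

  shift-prefix : ∀ π e α {L L'} → Pointwise (AffOnto (a ((π ++ e ∷ []) ++ α))) (map ((π ++ e ∷ []) ++_) L) (map ((π ++ e ∷ []) ++_) L')
               → Pointwise (AffOnto (a (π ++ e ∷ α))) (map (π ++_) (map (e ∷_) L)) (map (π ++_) (map (e ∷_) L'))
  shift-prefix π e α {L} {L'} p =
    subst₂ (Pointwise (AffOnto (a (π ++ e ∷ α)))) (snoc-prefix L) (snoc-prefix L') (subst (λ z → Pointwise (AffOnto (a z)) _ _) (++-assoc π (e ∷ []) α) p)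
    where
    snoc-prefix : ∀ M → map ((π ++ e ∷ []) ++_) M ≡ map (π ++_) (map (e ∷_) M)
    snoc-prefix M = trans (map-cong (λ x → ++-assoc π (e ∷ []) x) M) (sym (map-++-∷ π e M))

  -- A left rotation at α is the action of a_α on the leaves (under a common prefix π):
  -- below α by the rotation shapes, elsewhere a_α fixes the leaf intervals.
  rot-acts : ∀ {α T T'} → LeftRotAt α T T' → ∀ π → Pointwise (AffOnto (a (π ++ α))) (map (π ++_) (leaves T)) (map (π ++_) (leaves T'))
  rot-acts (root {t₀} {t₁} {t₂}) π rewrite ++-identityʳ π =
    subst₂ (Pointwise (AffOnto (a π))) (sym srcEq) (sym tgtEq)
      (PW.++⁺ (pointwise-map _ _ (leaves t₀) (λ μ → a-shape π (sh0 μ))) (PW.++⁺ (pointwise-map _ _ (leaves t₁) (λ μ → a-shape π (sh10 μ))) (pointwise-map _ _ (leaves t₂) (λ μ → a-shape π (sh11 μ)))))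
    where
    L0 = leaves t₀
    L1 = leaves t₁
    L2 = leaves t₂
    srcEq : map (π ++_) (map (false ∷_) L0 ++ map (true ∷_) (map (false ∷_) L1 ++ map (true ∷_) L2))
          ≡ map (λ x → π ++ false ∷ x) L0 ++ (map (λ x → π ++ true ∷ false ∷ x) L1 ++ map (λ x → π ++ true ∷ true ∷ x) L2)
    srcEq = trans (map-++ (π ++_) (map (false ∷_) L0) _) (cong₂ _++_ (map-++-∷ π false L0)
              (trans (cong (map (π ++_)) (map-++ (true ∷_) (map (false ∷_) L1) _)) (trans (map-++ (π ++_) (map (true ∷_) (map (false ∷_) L1)) _)
                (cong₂ _++_ (map-++-∷∷ π true false L1) (map-++-∷∷ π true true L2)))))
    tgtEq : map (π ++_) (map (false ∷_) (map (false ∷_) L0 ++ map (true ∷_) L1) ++ map (true ∷_) L2)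
          ≡ map (λ x → π ++ false ∷ false ∷ x) L0 ++ (map (λ x → π ++ false ∷ true ∷ x) L1 ++ map (λ x → π ++ true ∷ x) L2)
    tgtEq = trans (map-++ (π ++_) (map (false ∷_) (map (false ∷_) L0 ++ map (true ∷_) L1)) _)
              (trans (cong₂ _++_ (trans (cong (map (π ++_)) (map-++ (false ∷_) (map (false ∷_) L0) _)) (map-++ (π ++_) (map (false ∷_) (map (false ∷_) L0)) _)) (map-++-∷ π true L2))
                (trans (++-assoc (map (π ++_) (map (false ∷_) (map (false ∷_) L0))) _ _)
                  (cong₂ _++_ (map-++-∷∷ π false false L0) (cong₂ _++_ (map-++-∷∷ π false true L1) refl))))
  rot-acts (left {α} {t} {t'} {u} r) π =
    subst₂ (Pointwise (AffOnto (a (π ++ false ∷ α)))) (sym (map-++ (π ++_) (map (false ∷_) (leaves t)) _)) (sym (map-++ (π ++_) (map (false ∷_) (leaves t')) _))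
      (PW.++⁺ (shift-prefix π false α (rot-acts r (π ++ false ∷ [])))
        (subst₂ (Pointwise (AffOnto (a (π ++ false ∷ α)))) (sym (map-++-∷ π true (leaves u))) (sym (map-++-∷ π true (leaves u)))
          (pointwise-map _ _ (leaves u) (λ μ → a-incomparable {π ++ true ∷ μ} {π ++ false ∷ α} (π , α , μ , inj₂ (refl , refl))))))
  rot-acts (right {α} {t} {u} {u'} r) π =
    subst₂ (Pointwise (AffOnto (a (π ++ true ∷ α)))) (sym (map-++ (π ++_) (map (false ∷_) (leaves t)) _)) (sym (map-++ (π ++_) (map (false ∷_) (leaves t)) _))
      (PW.++⁺ (subst₂ (Pointwise (AffOnto (a (π ++ true ∷ α)))) (sym (map-++-∷ π false (leaves t))) (sym (map-++-∷ π false (leaves t)))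
                 (pointwise-map _ _ (leaves t) (λ μ → a-incomparable {π ++ false ∷ μ} {π ++ true ∷ α} (π , μ , α , inj₁ (refl , refl)))))
              (shift-prefix π true α (rot-acts r (π ++ true ∷ []))))

  rot-acts-root : ∀ {α T T'} → LeftRotAt α T T' → Acts T (a α) T'
  rot-acts-root {α} {T} {T'} r = rot-size r , subst₂ (Pointwise (AffOnto (a α))) (map-id (leaves T)) (map-id (leaves T')) (rot-acts r [])

  pointwise-id : ∀ (L : List Addr) → Pointwise (AffOnto (λ x → x)) L L
  pointwise-id [] = []
  pointwise-id (γ ∷ L) = affOnto-identity {λ x → x} {γ} (λ x _ → refl) ∷ pointwise-id L

  pointwise-∘ : ∀ {f g : ℚ → ℚ} {xs ys zs} → Pointwise (AffOnto f) xs ys → Pointwise (AffOnto g) ys zs → Pointwise (AffOnto (λ x → g (f x))) xs zs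
  pointwise-∘ [] [] = []
  pointwise-∘ {f} {g} {x ∷ xs} {y ∷ ys} {z ∷ zs} (h ∷ hs) (k ∷ ks) = aff-comp {f} {g} {x} {y} {z} h k ∷ pointwise-∘ {f} {g} hs ks

  acts-comp : ∀ {T T1 T2 f g} → Acts T f T1 → Acts T1 g T2 → Acts T (λ x → g (f x)) T2
  acts-comp {f = f} {g} (s1 , p1) (s2 , p2) = trans s1 s2 , pointwise-∘ {f} {g} p1 p2

  rotSeq-acts : ∀ {w T T'} → RotSeq w T T' → Acts T (evalW w) T'
  rotSeq-acts {T = T} rs-nil = refl , pointwise-id (leaves T)
  rotSeq-acts (rs-cons {α} {w} r s) = acts-comp {f = a α} {g = evalW w} (rot-acts-root r) (rotSeq-acts s)

  tamari-acts : ∀ {T T'} → T ≤T T' → ∃[ w ] Acts T (evalW w) T'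
  tamari-acts {T} ε = [] , refl , pointwise-id (leaves T)
  tamari-acts ((α , r) ◅ s) with tamari-acts s
  ... | (w , ac) = α ∷ w , acts-comp {f = a α} {g = evalW w} (rot-acts-root r) ac

  pointwise-lookup : ∀ {R : Addr → Addr → Set} {xs ys} → Pointwise R xs ys → ∀ j {x} → head (drop j xs) ≡ just x → ∃[ y ] (head (drop j ys) ≡ just y × R x y)
  pointwise-lookup (h ∷ hs) zero refl = _ , refl , h
  pointwise-lookup (h ∷ hs) (suc j) e = pointwise-lookup hs j e

  -- If a monotone right-anchored map acts from T to T', then ▷_T ⊆ ▷_T': for j ▷_T i via
  -- γ, right-anchoredness at I_γ gives a dyadic interval ending with the new interval of
  -- j and starting before the new interval of i, so j ▷_T' i by anchored⇒ones.
  acts⇒coverIncl : ∀ {T T' f} → Acts T f T' → RightAnchored f → Monotone f → CoverIncl T T'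
  acts⇒coverIncl {T} {T'} {f} (_ , pw) pf mf i j (i<j , γ , p , β , ej , ei) with pointwise-lookup pw j ej | pointwise-lookup pw i ei
  ... | (λj' , ej' , affj) | (λi' , ei' , affi) with leaves-order T' i j i<j ei' ej'
  ...   | (c , μ , ν , refl , refl) with pf γ
  ...     | (δ , eδ , sδ) = i<j , c , length ν , μ , trans ej' (cong (λ z → just (c ++ true ∷ z)) νones) , ei'
    where
    eE : end δ ≡ end (c ++ true ∷ ν)
    eE = trans eδ (trans (cong f (sym (ones-end γ (suc p)))) (aff-end {f} {γ ++ replicate (suc p) true} {c ++ true ∷ ν} affj))
    sL : start δ ≤q start (c ++ false ∷ μ)
    sL = ≤q-trans sδ (≤-rw (aff-start {f} {γ ++ false ∷ β} {c ++ false ∷ μ} affi) (mf (sub-start γ (false ∷ β))))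
    νones : ν ≡ replicate (length ν) true
    νones = anchored⇒ones c μ ν δ eE sL

  rightAnchored-ext : ∀ {f g} → (∀ x → f x ≡ g x) → RightAnchored g → RightAnchored f
  rightAnchored-ext {f} {g} e pg γ with pg γ
  ... | (δ , e1 , l1) = δ , trans e1 (sym (e (end γ))) , subst (start δ ≤q_) (sym (e (start γ))) l1

  monotone-ext : ∀ {f g} → (∀ x → f x ≡ g x) → Monotone g → Monotone f
  monotone-ext {f} {g} e mg {x} {y} h = subst₂ _≤q_ (sym (e x)) (sym (e y)) (mg h)

  fsym⁺-acts⇒coverIncl : ∀ {T T' f} → InFsym⁺ f → Acts T f T' → CoverIncl T T'
  fsym⁺-acts⇒coverIncl {f = f} (w , f≗w) ac =
    acts⇒coverIncl ac (rightAnchored-ext {f} {evalW w} f≗w (evalW-rightAnchored w)) (monotone-ext {f} {evalW w} f≗w (evalW-monotone w))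

open import Data.Nat using (_<_; _≤_; z≤n; s≤s)
open import Data.Nat.Properties using (<-≤-trans; ≤-trans; ≤-refl; <⇒≤; n<1+n; ≤-pred)
open Combinatorics using (CoverIncl; WeightDom; weightDom⇒coverIncl; coverIncl⇒weightDom; tamari-weightDom; rot-rotMeasure; rotMeasure; RotSeq; rs-nil; rs-cons; rotSeq⇒tamari; rotSeq-size; polishStep)
open Dyadic using (tamari-acts; rotSeq-acts; fsym⁺-acts⇒coverIncl)

_≟T_ : (T T' : Tree) → Dec (T ≡ T')
● ≟T ● = yes refl
● ≟T (_ ∧ᵗ _) = no (λ ())
(_ ∧ᵗ _) ≟T ● = no (λ ())
(A ∧ᵗ B) ≟T (A' ∧ᵗ B') with A ≟T A' | B ≟T B'
... | yes refl | yes refl = yes refl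
... | no n | _ = no (λ { refl → n refl })
... | yes _ | no n = no (λ { refl → n refl })

rotSeq-measure≤ : ∀ {w T T'} → RotSeq w T T' → rotMeasure T' ≤ rotMeasure T
rotSeq-measure≤ rs-nil = ≤-refl
rotSeq-measure≤ (rs-cons r s) = ≤-trans (rotSeq-measure≤ s) (<⇒≤ (rot-rotMeasure r))

rotSeq-measure< : ∀ {α w T T'} → RotSeq (α ∷ w) T T' → rotMeasure T' < rotMeasure T
rotSeq-measure< (rs-cons r s) = <-≤-trans (s≤s (rotSeq-measure≤ s)) (rot-rotMeasure r)

TamariByPositiveWord : Tree → Tree → Set
TamariByPositiveWord T T' = (T ≤T T') × ∃[ w ] (PolishS T T' w × All IsPos w)

-- Running the Polish algorithm on a dominated pair: each step is a forward step
-- (polishStep), so the word is positive and the steps compose to T ≤ T'. The fuel n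
-- bounds the measure, which every step decreases.
polishAlgorithm : ∀ n T → rotMeasure T < n → ∀ T' → size T ≡ size T' → WeightDom T T' → TamariByPositiveWord T T'
polishAlgorithm zero T () T' es dom
polishAlgorithm (suc n) T h T' es dom with T ≟T T'
... | yes refl = ε , [] , done , []
... | no T≢T' with polishStep T T' es dom T≢T'
...   | (α , zero , T'' , k , rots , () , lex , sym-eq , dom'')
...   | (α , suc m , T'' , k , rots , _ , lex , sym-eq , dom'')
  with polishAlgorithm n T'' (<-≤-trans (rotSeq-measure< rots) (≤-pred h)) T' (trans (sym (rotSeq-size rots)) es) dom''
...     | (T''≤T' , w , run , allPos) =
  rotSeq⇒tamari rots ◅◅ T''≤T' , pos α (suc m) ∷ w , fwd (s≤s z≤n , k , lex , rotSeq-acts rots , sym-eq) run , isPos ∷ allPos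

¬allPos-withNeg : ∀ {α r} (w : List Letter) → ¬ All IsPos (w ++ neg α r ∷ [])
¬allPos-withNeg [] (() ∷ _)
¬allPos-withNeg (x ∷ w) (_ ∷ ap) = ¬allPos-withNeg w ap

-- (iii) ⇒ (iv): a positive run consists of forward steps, each an action of F⁺_sym.
positiveWord⇒coverIncl : ∀ {T T' w} → PolishS T T' w → All IsPos w → CoverIncl T T'
positiveWord⇒coverIncl done _ i j c = c
positiveWord⇒coverIncl (fwd {α = α} {r} (_ , _ , _ , ac , _) run) (_ ∷ ap) i j c =
  positiveWord⇒coverIncl run ap i j (fsym⁺-acts⇒coverIncl (hatW α r , λ x → refl) ac i j c)
positiveWord⇒coverIncl (bwd {w = w} _ _) ap = ⊥-elim (¬allPos-withNeg w ap)

corollary4p12 : (T T' : Tree) → size T ≡ size T' →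
    ((T ≤T T') ⇔ (∃[ f ] (InFsym⁺ f × Acts T f T')))
    × ((T ≤T T') ⇔ (∃[ w ] (PolishS T T' w × All IsPos w)))
    × ((T ≤T T') ⇔ (∀ (i j : ℕ) → Covers T j i → Covers T' j i))
corollary4p12 T T' es = mk⇔ i⇒ii ii⇒i , mk⇔ i⇒iii iii⇒i , mk⇔ i⇒iv iv⇒i
  where
  runPolish : CoverIncl T T' → TamariByPositiveWord T T'
  runPolish inc = polishAlgorithm (suc (rotMeasure T)) T (n<1+n _) T' es (coverIncl⇒weightDom {T} {T'} inc)
  i⇒iv : T ≤T T' → CoverIncl T T'
  i⇒iv le = weightDom⇒coverIncl {T} {T'} (tamari-weightDom le)
  iv⇒i : CoverIncl T T' → T ≤T T'
  iv⇒i inc = proj₁ (runPolish inc)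
  i⇒ii : T ≤T T' → ∃[ f ] (InFsym⁺ f × Acts T f T')
  i⇒ii le with tamari-acts le
  ... | (w , ac) = evalW w , (w , λ x → refl) , ac
  ii⇒i : ∃[ f ] (InFsym⁺ f × Acts T f T') → T ≤T T'
  ii⇒i (f , inF , ac) = iv⇒i (fsym⁺-acts⇒coverIncl inF ac)
  i⇒iii : T ≤T T' → ∃[ w ] (PolishS T T' w × All IsPos w)
  i⇒iii le = proj₂ (runPolish (i⇒iv le))
  iii⇒i : ∃[ w ] (PolishS T T' w × All IsPos w) → T ≤T T'
  iii⇒i (w , run , allPos) = iv⇒i (positiveWord⇒coverIncl run allPos)
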